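{- Let $n\ge1$, let $\mathcal{F}\subset S_n$ with $|\mathcal{F}|=n!/2$, $f=2\chi_{\mathcal{F}}-1$, $f_1$ its orthogonal projection onto $U_1$, $\epsilon=\mathbb{E}[(f-f_1)^2]$, $a_{ij}=(n-1)\langle f,T_{ij}\rangle$, and call $a_{ij}$ large if $\big||a_{ij}|-1\big|\le50\epsilon^{1/7}$. Suppose $(X,Y)$ is $q$-good and that some line $\ell$ (a row $i\in X$ or a column $j\in Y$) is $p$-strong for $(X,Y)$. Let $m=|X|$ and $\varrho=2q/(1-p)$. If $m\ge6$, $(1-p)m>1$, $2\varrho m>1$ and $\varrho\le1/2$, then $\ell$ is $(q+3\varrho)$-strong for $(X,Y)$.
   Context: $T_{ij}=\{\sigma\in S_n:\sigma(i)=j\}$ (also its characteristic function); $U_1=\mathrm{span}\{T_{ij}\}$ with inner product $\langle f,g\rangle=\frac1{n!}\sum_\pi f(\pi)g(\pi)$. A restriction is a pair $(X,Y)$ with $X,Y\subset[n]$, $|X|=|Y|$. A generalized diagonal of $A[X,Y]=(a_{ij})_{i\in X,j\in Y}$ is $\{a_{i\sigma(i)}:i\in X\}$ for a bijection $\sigma:X\to Y$; it is good if it contains exactly one large entry. $(X,Y)$ is $q$-good if a uniformly random generalized diagonal of $A[X,Y]$ is good with probability at least $1-q$. For $i\in X$, row $i$ is $p$-strong for $(X,Y)$ if at least $(1-p)|Y|$ of the entries $a_{ij}$, $j\in Y$, are large; for $j\in Y$, column $j$ is $p$-strong for $(X,Y)$ if at least $(1-p)|X|$ of the entries $a_{ij}$,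 $i\in X$, are large.
   Formalization: The parameters p, q and ϱ are rational. -}

module Defs where

open import Data.Bool using (Bool; true; false; if_then_else_; _∧_; _∨_; not)
open import Data.Nat as ℕ using (ℕ; zero; suc; _∸_)
open import Data.Nat.Base using () renaming (_! to _!ℕ)
open import Data.Fin as Fin using (Fin)
open import Data.Fin.Properties using () renaming (_≟_ to _≟ᶠ_)
open import Data.Fin.Subset using (Subset)
open import Data.Vec as Vec using (Vec; []; _∷_; lookup)
open import Data.List as List using (List; []; _∷_; map; concatMap; filterᵇ; length; allFin; foldr)
open import Data.Integer using (+_)
open import Data.Rational using (ℚ; 0ℚ; 1ℚ; _+_; _*_; _-_; -_; ∣_∣; _≤_; _/_)
open import Data.Rational.Properties using (_≤?_)
open import Relation.Nullary.Decidable using (does)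
open import Data.Product using (_×_)
open import Relation.Binary.PropositionalEquality using (_≡_)

ℕ→ℚ : ℕ → ℚ
ℕ→ℚ k = (+ k) / 1

-- 1/k for k ≥ 1 (value at 0 is irrelevant: only used with k = n! ≥ 1)
invℕ : ℕ → ℚ
invℕ zero    = 0ℚ
invℕ (suc k) = (+ 1) / (suc k)

_^_ : ℚ → ℕ → ℚ
x ^ zero  = 1ℚ
x ^ suc k = x * (x ^ k)

sumℚ : List ℚ → ℚ
sumℚ = foldr _+_ 0ℚ

allᵇ : ∀ {n} → (Fin n → Bool) → Bool
allᵇ P = foldr (λ i b → P i ∧ b) true (allFin _)

_==_ : ∀ {n} → Fin n → Fin n → Bool
i == j = does (i ≟ᶠ j)

countFin : ∀ {n} → (Fin n → Bool) → ℕ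
countFin P = length (filterᵇ P (allFin _))

Map : ℕ → Set
Map n = Vec (Fin n) n

vecs : (n k : ℕ) → List (Vec (Fin n) k)
vecs n zero    = [] ∷ []
vecs n (suc k) = concatMap (λ i → map (i ∷_) (vecs n k)) (allFin n)

-- σ is a permutation (injective, hence bijective on Fin n)
isPerm : ∀ {n} → Map n → Bool
isPerm σ = allᵇ (λ i → allᵇ (λ j → not (lookup σ i == lookup σ j) ∨ (i == j)))

Sym : (n : ℕ) → List (Map n)
Sym n = filterᵇ isPerm (vecs n n)

⟨_,_⟩ : ∀ {n} → (Map n → ℚ) → (Map n → ℚ) → ℚ
⟨_,_⟩ {n} g h = invℕ (n !ℕ) * sumℚ (map (λ π → g π * h π) (Sym n))

T : ∀ {n} → Fin n → Fin n → Map n → ℚ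
T i j π = if lookup π i == j then 1ℚ else 0ℚ

-- the element Σ_{k,l} c_kl T_kl of U_1 = span{T_ij}
spanT : ∀ {n} → (Fin n → Fin n → ℚ) → Map n → ℚ
spanT {n} c π = sumℚ (map (λ k → sumℚ (map (λ l → c k l * T k l π) (allFin n))) (allFin n))

-- spanT c is the orthogonal projection of g onto U_1:
-- it lies in U_1 and g - spanT c is orthogonal to every T_ij
IsProjU1 : ∀ {n} → (Map n → ℚ) → (Fin n → Fin n → ℚ) → Set
IsProjU1 g c = ∀ i j → ⟨ (λ π → g π - spanT c π) , T i j ⟩ ≡ 0ℚ

card : ∀ {n} → (Map n → Bool) → ℕ
card {n} F = length (filterᵇ F (Sym n))

fOf : ∀ {n} → (Map n → Bool) → Map n → ℚ
fOf F π = if F π then 1ℚ else - 1ℚ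

epsOf : ∀ {n} → (Map n → ℚ) → (Map n → ℚ) → ℚ
epsOf f f1 = ⟨ (λ π → f π - f1 π) , (λ π → f π - f1 π) ⟩

aOf : ∀ {n} → (Map n → ℚ) → Fin n → Fin n → ℚ
aOf {n} f i j = ℕ→ℚ (n ∸ 1) * ⟨ f , T i j ⟩

-- a is large iff | |a| - 1 | ≤ 50 ε^{1/7}, i.e. (for ε ≥ 0)
-- | |a| - 1 |^7 ≤ 50^7 ε
isLarge : ℚ → ℚ → Bool
isLarge ε x = does ((∣ ∣ x ∣ - 1ℚ ∣ ^ 7) ≤? ((ℕ→ℚ 50 ^ 7) * ε))

-- Restrictions, generalized diagonals, q-good, p-strong
-- L i j = true  means  a_ij is large

-- Bijections σ : X → Y, represented canonically as vectors v with
-- v(i) ∈ Y for i ∈ X, v injective on X, and v(i) = i for i ∉ X.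
isBij : ∀ {n} → Subset n → Subset n → Map n → Bool
isBij X Y v =
  allᵇ (λ i → if lookup X i then lookup Y (lookup v i) else (lookup v i == i))
  ∧ allᵇ (λ i → allᵇ (λ j →
      not (lookup X i ∧ lookup X j ∧ (lookup v i == lookup v j)) ∨ (i == j)))

bijections : ∀ {n} → Subset n → Subset n → List (Map n)
bijections {n} X Y = filterᵇ (isBij X Y) (vecs n n)

isGoodDiag : ∀ {n} → (Fin n → Fin n → Bool) → Subset n → Map n → Bool
isGoodDiag L X v = countFin (λ i → lookup X i ∧ L i (lookup v i)) ℕ.≡ᵇ 1

QGood : ∀ {n} → (Fin n → Fin n → Bool) → Subset n → Subset n → ℚ → Set
QGood L X Y q =
  (1ℚ - q) * ℕ→ℚ (length (bijections X Y))
    ≤ ℕ→ℚ (length (filterᵇ (isGoodDiag L X) (bijections X Y)))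

sizeOf : ∀ {n} → Subset n → ℕ
sizeOf X = countFin (lookup X)

RowStrong : ∀ {n} → (Fin n → Fin n → Bool) → Subset n → Subset n → ℚ → Fin n → Set
RowStrong L X Y p i =
  (1ℚ - p) * ℕ→ℚ (sizeOf Y) ≤ ℕ→ℚ (countFin (λ j → lookup Y j ∧ L i j))

ColStrong : ∀ {n} → (Fin n → Fin n → Bool) → Subset n → Subset n → ℚ → Fin n → Set
ColStrong L X Y p j =
  (1ℚ - p) * ℕ→ℚ (sizeOf X) ≤ ℕ→ℚ (countFin (λ i → lookup X i ∧ L i j))

data Line (n : ℕ) : Set where
  row : Fin n → Line n
  col : Fin n → Line n

LineOf : ∀ {n} → Subset n → Subset n → Line n → Set
LineOf X Y (row i) = lookup X i ≡ true
LineOf X Y (col j) = lookup Y j ≡ true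

Strong : ∀ {n} → (Fin n → Fin n → Bool) → Subset n → Subset n → ℚ → Line n → Set
Strong L X Y p (row i) = RowStrong L X Y p i
Strong L X Y p (col j) = ColStrong L X Y p j

module Submission where

-- Let the line ℓ meet the restriction (X, Y) in k large and k′ small entries, k + k′ = m. Switching a
-- diagonal σ : X → Y to σ ∘ (x₁ x₂) permutes the diagonals, so weighted counts of switches can be taken
-- before or after switching. Counting the switches that move the entry of σ on ℓ from a small to a large
-- one shows that a k′/m share of all diagonals meets ℓ in a small entry. A good diagonal meeting ℓ in a
-- small entry has at least k − 1 switches that make its ℓ-entry large while keeping its one large entry,
-- so they produce bad diagonals meeting ℓ in a large entry, and every diagonal arises from at most m − 1
-- switches. As at most a q-share of the diagonals is bad, this gives (k − 1) k′ ≤ m (m + k − 2) q, and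
-- with q m ≤ ϱ (k − 1), which follows from ϱ (1 − p) = 2q and (1 − p) m ≤ k, finally k′ ≤ (q + ϱ) m.

open import Data.Bool using (Bool; true; false; _∧_; _∨_; not; if_then_else_)
open import Data.Bool.Properties using (T-≡; ∧-assoc; ∧-comm; ∧-identityʳ; ∧-zeroʳ)
open import Data.Empty using (⊥; ⊥-elim)
open import Data.Fin using (Fin; zero; suc)
open import Data.Fin.Permutation.Components using (transpose)
open import Data.Fin.Properties using (_≟_) renaming (suc-injective to suc-injectiveᶠ)
open import Data.Fin.Subset using (Subset)
open import Data.Integer using (+≤+; +<+) renaming (+_ to +ℤ_; _≤_ to _≤ℤ_; _+_ to _+ℤ_)
import Data.Integer.Properties as ℤ
open import Data.List using (List; []; _∷_; _++_; length; map; foldr; filterᵇ; concatMap; cartesianProductWith; allFin)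
open import Data.List.Membership.Propositional using (_∈_)
open import Data.List.Membership.Propositional.Properties using (∈-cartesianProductWith⁺; ∈-allFin; ∈-map⁺; ∈-map⁻; ∈-filter⁺; ∈-filter⁻)
open import Data.List.Properties using (map-tabulate)
open import Data.List.Relation.Unary.All using (All; []; _∷_)
import Data.List.Relation.Unary.All as All
open import Data.List.Relation.Unary.Any using (here; there)
open import Data.List.Relation.Unary.Unique.Propositional using (Unique; []; _∷_)
open import Data.List.Relation.Unary.Unique.Propositional.Properties using (cartesianProductWith⁺; allFin⁺; map⁺; filter⁺)
open import Data.Nat using (ℕ; zero; suc; _+_; _*_; _≤_; _<_; z≤n; s≤s; s≤s⁻¹; _≡ᵇ_)
open import Data.Nat.Base using (_!)
open import Data.Nat.Divisibility using (∣1⇒≡1)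
open import Data.Nat.Properties hiding (_≟_)
open import Algebra.Properties.CommutativeSemigroup *-commutativeSemigroup using () renaming (x∙yz≈y∙xz to x*[y*z]≡y*[x*z])
open import Algebra.Properties.CommutativeSemigroup +-commutativeSemigroup using () renaming (interchange to +-interchange)
open import Data.Nat.Tactic.RingSolver using (solve-∀)
open import Data.Product using (∃; _,_; _×_; proj₁; proj₂)
open import Data.Rational using (ℚ; 0ℚ; 1ℚ; ½; mkℚ; _/_; *≤*; *<*; positive; nonNegative)
  renaming (_+_ to _+ℚ_; _*_ to _*ℚ_; _-_ to _-ℚ_; _≤_ to _≤ℚ_; _<_ to _<ℚ_)
import Data.Rational.Properties as ℚ
open import Data.Rational.Solver using (module +-*-Solver)
open import Data.Sum using (inj₁; inj₂)
open import Data.Vec using (Vec; []; _∷_; lookup)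
import Data.Vec as Vec
open import Data.Vec.Properties using (∷-injective; lookup∘tabulate; tabulate∘lookup; tabulate-cong; ≡-dec)
open import Function using (_∘_; Equivalence)
open import Relation.Binary.Definitions using (DecidableEquality)
open import Relation.Binary.PropositionalEquality
open import Relation.Nullary using (Dec; yes; no; does)
open import Relation.Nullary.Decidable using (dec-true; dec-false; T?)

open import Defs using ( _==_; allᵇ; countFin; Map; vecs; isBij; bijections; isGoodDiag; QGood; sizeOf; Strong
                       ; Line; row; col; LineOf; card; IsProjU1; fOf; spanT; epsOf; aOf; isLarge; ℕ→ℚ)

-- Indicators and finite sums

∧-true⁻ : ∀ {a b} → a ∧ b ≡ true → a ≡ true × b ≡ true
∧-true⁻ {true} {true} _ = refl , refl

𝟙 : Bool → ℕ
𝟙 true  = 1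
𝟙 false = 0

𝟙-∧ : ∀ a b → 𝟙 (a ∧ b) ≡ 𝟙 a * 𝟙 b
𝟙-∧ true  b = sym (+-identityʳ (𝟙 b))
𝟙-∧ false b = refl

𝟙-+-𝟙-not : ∀ a → 𝟙 a + 𝟙 (not a) ≡ 1
𝟙-+-𝟙-not true  = refl
𝟙-+-𝟙-not false = refl

not-true⇒false : ∀ {b} → not b ≡ true → b ≡ false
not-true⇒false {false} _ = refl

𝟙-not-∧ : ∀ c x q → 𝟙 (not c) * 𝟙 (x ∧ q) ≡ 𝟙 (x ∧ not c) * 𝟙 q
𝟙-not-∧ c true  q = refl
𝟙-not-∧ c false q = *-zeroʳ (𝟙 (not c))

𝟙-*-cong : ∀ b {e k} → (b ≡ true → e ≡ k) → 𝟙 b * e ≡ 𝟙 b * k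
𝟙-*-cong true  e≡k = cong (1 *_) (e≡k refl)
𝟙-*-cong false _   = refl

𝟙-*-≤ : ∀ b {e k} → (b ≡ true → e ≤ k) → 𝟙 b * e ≤ 𝟙 b * k
𝟙-*-≤ true  e≤k = *-monoʳ-≤ 1 (e≤k refl)
𝟙-*-≤ false _   = z≤n

𝟙-∧-last : ∀ a b c d → 𝟙 (a ∧ b ∧ c ∧ d) ≡ 𝟙 (a ∧ b ∧ c) * 𝟙 d
𝟙-∧-last true  true  true  d = sym (*-identityˡ (𝟙 d))
𝟙-∧-last true  true  false d = refl
𝟙-∧-last true  false c     d = refl
𝟙-∧-last false b     c     d = refl

𝟙-mono : ∀ {b c} → (b ≡ true → c ≡ true) → 𝟙 b ≤ 𝟙 c
𝟙-mono {true}  b⇒c rewrite b⇒c refl = ≤-refl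
𝟙-mono {false} _   = z≤n

∑ : {A : Set} → List A → (A → ℕ) → ℕ
∑ []       f = 0
∑ (x ∷ xs) f = f x + ∑ xs f

module _ {A : Set} where

  ∑-cong : ∀ (xs : List A) {f g} → (∀ x → f x ≡ g x) → ∑ xs f ≡ ∑ xs g
  ∑-cong []       f≗g = refl
  ∑-cong (x ∷ xs) f≗g = cong₂ _+_ (f≗g x) (∑-cong xs f≗g)

  ∑-cong-All : ∀ {P : A → Set} {xs f g} → All P xs → (∀ x → P x → f x ≡ g x) → ∑ xs f ≡ ∑ xs g
  ∑-cong-All []         f≗g = refl
  ∑-cong-All (px ∷ pxs) f≗g = cong₂ _+_ (f≗g _ px) (∑-cong-All pxs f≗g)

  ∑-mono : ∀ (xs : List A) {f g} → (∀ x → f x ≤ g x) → ∑ xs f ≤ ∑ xs g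
  ∑-mono []       f≤g = z≤n
  ∑-mono (x ∷ xs) f≤g = +-mono-≤ (f≤g x) (∑-mono xs f≤g)

  ∑-mono-All : ∀ {P : A → Set} {xs f g} → All P xs → (∀ x → P x → f x ≤ g x) → ∑ xs f ≤ ∑ xs g
  ∑-mono-All []         f≤g = z≤n
  ∑-mono-All (px ∷ pxs) f≤g = +-mono-≤ (f≤g _ px) (∑-mono-All pxs f≤g)

  ∑-+ : ∀ (xs : List A) f g → ∑ xs (λ x → f x + g x) ≡ ∑ xs f + ∑ xs g
  ∑-+ []       f g = refl
  ∑-+ (x ∷ xs) f g = trans (cong ((f x + g x) +_) (∑-+ xs f g)) (+-interchange (f x) (g x) (∑ xs f) (∑ xs g))

  ∑-*ˡ : ∀ (xs : List A) c f → ∑ xs (λ x → c * f x) ≡ c * ∑ xs f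
  ∑-*ˡ []       c f = sym (*-zeroʳ c)
  ∑-*ˡ (x ∷ xs) c f = trans (cong (c * f x +_) (∑-*ˡ xs c f)) (sym (*-distribˡ-+ c (f x) _))

  ∑-*ʳ : ∀ (xs : List A) c f → ∑ xs (λ x → f x * c) ≡ ∑ xs f * c
  ∑-*ʳ xs c f = trans (∑-cong xs (λ x → *-comm (f x) c)) (trans (∑-*ˡ xs c f) (*-comm c _))

  ∑-zero : ∀ (xs : List A) {f} → (∀ x → f x ≡ 0) → ∑ xs f ≡ 0
  ∑-zero xs f≗0 = trans (∑-cong xs f≗0) (∑-const0 xs)
    where
    ∑-const0 : ∀ (xs : List A) → ∑ xs (λ _ → 0) ≡ 0
    ∑-const0 []       = refl
    ∑-const0 (_ ∷ xs) = ∑-const0 xs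

  ∑-zero-All : ∀ {P : A → Set} {xs f} → All P xs → (∀ x → P x → f x ≡ 0) → ∑ xs f ≡ 0
  ∑-zero-All []         f≗0 = refl
  ∑-zero-All (px ∷ pxs) f≗0 = cong₂ _+_ (f≗0 _ px) (∑-zero-All pxs f≗0)

  ∑-const1 : ∀ (xs : List A) → ∑ xs (λ _ → 1) ≡ length xs
  ∑-const1 []       = refl
  ∑-const1 (_ ∷ xs) = cong suc (∑-const1 xs)

  length-filterᵇ : ∀ (P : A → Bool) xs → length (filterᵇ P xs) ≡ ∑ xs (𝟙 ∘ P)
  length-filterᵇ P []       = refl
  length-filterᵇ P (x ∷ xs) with P x
  ... | true  = cong suc (length-filterᵇ P xs)
  ... | false = length-filterᵇ P xs

  ∑-map : ∀ {B : Set} (g : B → A) (xs : List B) f → ∑ (map g xs) f ≡ ∑ xs (f ∘ g)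
  ∑-map g []       f = refl
  ∑-map g (x ∷ xs) f = cong (f (g x) +_) (∑-map g xs f)

  ∑-𝟙≢0⇒∃ : ∀ (xs : List A) (P : A → Bool) → ∑ xs (𝟙 ∘ P) ≢ 0 → ∃ λ x → P x ≡ true
  ∑-𝟙≢0⇒∃ []       P ≢0 = ⊥-elim (≢0 refl)
  ∑-𝟙≢0⇒∃ (x ∷ xs) P ≢0 with P x in Px
  ... | true  = x , Px
  ... | false = ∑-𝟙≢0⇒∃ xs P ≢0

∑-swap : ∀ {A B : Set} (xs : List A) (ys : List B) (f : A → B → ℕ) →
         ∑ xs (λ x → ∑ ys (f x)) ≡ ∑ ys (λ y → ∑ xs (λ x → f x y))
∑-swap []       ys f = sym (∑-zero ys (λ _ → refl))
∑-swap (x ∷ xs) ys f = trans (cong (∑ ys (f x) +_) (∑-swap xs ys f)) (sym (∑-+ ys (f x) _))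

∑Fin : (n : ℕ) → (Fin n → ℕ) → ℕ
∑Fin n = ∑ (allFin n)

infix 5 ∑Fin
syntax ∑Fin n (λ x → e) = ∑[ x < n ] e

count : ∀ {n} → (Fin n → Bool) → ℕ
count {n} P = ∑[ x < n ] 𝟙 (P x)

∑Fin-suc : ∀ n f → ∑Fin (suc n) f ≡ f zero + ∑Fin n (f ∘ suc)
∑Fin-suc n f = cong (f zero +_) (trans (cong (λ xs → ∑ xs f) (sym (map-tabulate (λ i → i) suc))) (∑-map suc (allFin n) f))

module _ {n : ℕ} where

  ==-refl : (i : Fin n) → (i == i) ≡ true
  ==-refl i = dec-true (i ≟ i) refl

  ==-≢ : {i j : Fin n} → i ≢ j → (i == j) ≡ false
  ==-≢ = dec-false (_ ≟ _)

  ==⇒≡ : {i j : Fin n} → (i == j) ≡ true → i ≡ j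
  ==⇒≡ {i} {j} i==j with i ≟ j
  ... | yes i≡j = i≡j

  ==-sym : (i j : Fin n) → (i == j) ≡ (j == i)
  ==-sym i j with i ≟ j
  ... | yes i≡j = sym (dec-true (j ≟ i) (sym i≡j))
  ... | no  i≢j = sym (dec-false (j ≟ i) (i≢j ∘ sym))

∑-δ : ∀ n (z : Fin n) (f : Fin n → ℕ) → ∑[ y < n ] 𝟙 (z == y) * f y ≡ f z
∑-δ (suc n) zero f = begin
  ∑[ y < suc n ] 𝟙 (zero == y) * f y         ≡⟨ ∑Fin-suc n (λ y → 𝟙 (zero == y) * f y) ⟩
  (f zero + 0) + (∑[ y < n ] 0 * f (suc y))  ≡⟨ cong₂ _+_ (+-identityʳ (f zero)) (∑-zero (allFin n) (λ _ → refl)) ⟩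
  f zero + 0                                  ≡⟨ +-identityʳ (f zero) ⟩
  f zero                                      ∎
  where open ≡-Reasoning
∑-δ (suc n) (suc z) f = trans (∑Fin-suc n (λ y → 𝟙 (suc z == y) * f y)) (∑-δ n z (f ∘ suc))

∑-split-at : ∀ n (z : Fin n) (f : Fin n → ℕ) → ∑Fin n f ≡ f z + (∑[ y < n ] 𝟙 (not (z == y)) * f y)
∑-split-at n z f = begin
  ∑Fin n f                                                              ≡⟨ ∑-cong (allFin n) split ⟩
  ∑[ y < n ] (𝟙 (z == y) * f y + 𝟙 (not (z == y)) * f y)                 ≡⟨ ∑-+ (allFin n) (λ y → 𝟙 (z == y) * f y) (λ y → 𝟙 (not (z == y)) * f y) ⟩
  (∑[ y < n ] 𝟙 (z == y) * f y) + (∑[ y < n ] 𝟙 (not (z == y)) * f y) ≡⟨ cong (_+ (∑[ y < n ] 𝟙 (not (z == y)) * f y)) (∑-δ n z f) ⟩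
  f z + (∑[ y < n ] 𝟙 (not (z == y)) * f y)                             ∎
  where
  open ≡-Reasoning
  split : ∀ y → f y ≡ 𝟙 (z == y) * f y + 𝟙 (not (z == y)) * f y
  split y = trans (sym (*-identityˡ (f y))) (trans (cong (_* f y) (sym (𝟙-+-𝟙-not (z == y)))) (*-distribʳ-+ (f y) (𝟙 (z == y)) (𝟙 (not (z == y)))))

count-remove : ∀ {n} (P : Fin n → Bool) (z : Fin n) → P z ≡ true → count P ≡ suc (count (λ x → P x ∧ not (z == x)))
count-remove {n} P z Pz = trans (∑-split-at n z (𝟙 ∘ P))
  (cong₂ _+_ (cong 𝟙 Pz) (∑-cong (allFin n) (λ x → trans (*-comm (𝟙 (not (z == x))) (𝟙 (P x))) (sym (𝟙-∧ (P x) _)))))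

count≡0 : ∀ n (P : Fin n → Bool) → count P ≡ 0 → ∀ x → P x ≡ false
count≡0 n P ∑≡0 x with P x in Px
... | false = refl
... | true with () ← trans (sym (count-remove P x Px)) ∑≡0

count≤1 : ∀ n (P : Fin n → Bool) → (∀ x y → P x ≡ true → P y ≡ true → x ≡ y) → count P ≤ 1
count≤1 zero    P unique = z≤n
count≤1 (suc n) P unique rewrite ∑Fin-suc n (𝟙 ∘ P) with P zero in P0
... | true  = ≤-reflexive (cong suc (∑-zero (allFin n) rest-false))
  where
  rest-false : ∀ y → 𝟙 (P (suc y)) ≡ 0
  rest-false y with P (suc y) in Psy
  ... | true with () ← unique zero (suc y) P0 Psy
  ... | false = refl
... | false = count≤1 n (P ∘ suc) (λ x y Px Py → suc-injectiveᶠ (unique (suc x) (suc y) Px Py))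

countFin≡count : ∀ {n} (P : Fin n → Bool) → countFin P ≡ count P
countFin≡count P = length-filterᵇ P (allFin _)

module _ {A : Set} (_≟ᴬ_ : DecidableEquality A) where

  private
    δ : A → A → ℕ
    δ w z = 𝟙 (does (w ≟ᴬ z))

    ∑-cong-∈ : ∀ (xs : List A) {f g} → (∀ x → x ∈ xs → f x ≡ g x) → ∑ xs f ≡ ∑ xs g
    ∑-cong-∈ []       f≗g = refl
    ∑-cong-∈ (x ∷ xs) f≗g = cong₂ _+_ (f≗g x (here refl)) (∑-cong-∈ xs (λ y y∈xs → f≗g y (there y∈xs)))

    ∑-δ-unique : ∀ {xs z} → Unique xs → z ∈ xs → ∑ xs (λ w → δ w z) ≡ 1
    ∑-δ-unique {x ∷ xs} (x∉xs ∷ _) (here refl) =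
      cong₂ _+_ (cong 𝟙 (dec-true (x ≟ᴬ x) refl)) (∑-zero-All x∉xs (λ w x≢w → cong 𝟙 (dec-false (w ≟ᴬ x) (x≢w ∘ sym))))
    ∑-δ-unique {x ∷ xs} {z} (x∉xs ∷ u) (there z∈xs) =
      cong₂ _+_ (cong 𝟙 (dec-false (x ≟ᴬ z) (λ { refl → All.lookup x∉xs z∈xs refl }))) (∑-δ-unique u z∈xs)

    ∑-weighted : ∀ {xs z} (f : A → ℕ) → Unique xs → z ∈ xs → ∑ xs (λ w → δ w z) * f z ≡ f z
    ∑-weighted f u z∈xs = trans (cong (_* f _) (∑-δ-unique u z∈xs)) (+-identityʳ _)

  -- Both sums equal the double sum of δ w z * f z over xs × ys.
  ∑-same-members : ∀ (xs ys : List A) (f : A → ℕ) → Unique xs → Unique ys →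
                   (∀ z → z ∈ xs → z ∈ ys) → (∀ z → z ∈ ys → z ∈ xs) → ∑ xs f ≡ ∑ ys f
  ∑-same-members xs ys f uxs uys xs⊆ys ys⊆xs = begin
    ∑ xs f                                       ≡⟨ ∑-cong-∈ xs (λ w w∈xs → sym (∑-weighted f uys (xs⊆ys w w∈xs))) ⟩
    ∑ xs (λ w → ∑ ys (λ z → δ z w) * f w)         ≡⟨ ∑-cong xs (λ w → sym (∑-*ʳ ys (f w) (λ z → δ z w))) ⟩
    ∑ xs (λ w → ∑ ys (λ z → δ z w * f w))         ≡⟨ ∑-swap xs ys (λ w z → δ z w * f w) ⟩
    ∑ ys (λ z → ∑ xs (λ w → δ z w * f w))         ≡⟨ ∑-cong ys (λ z → ∑-cong xs (λ w → δ-at z w)) ⟩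
    ∑ ys (λ z → ∑ xs (λ w → δ w z * f z))         ≡⟨ ∑-cong ys (λ z → ∑-*ʳ xs (f z) (λ w → δ w z)) ⟩
    ∑ ys (λ z → ∑ xs (λ w → δ w z) * f z)         ≡⟨ ∑-cong-∈ ys (λ z z∈ys → ∑-weighted f uxs (ys⊆xs z z∈ys)) ⟩
    ∑ ys f                                       ∎
    where
    open ≡-Reasoning
    δ-at : ∀ z w → δ z w * f w ≡ δ w z * f z
    δ-at z w with z ≟ᴬ w | w ≟ᴬ z
    ... | yes refl | yes _   = refl
    ... | yes refl | no  z≢z = ⊥-elim (z≢z refl)
    ... | no  z≢w  | yes w≡z = ⊥-elim (z≢w (sym w≡z))
    ... | no  _    | no  _   = refl

-- The bijections X → Y and switches

concatMap-map≡cartesianProductWith : ∀ {A B C : Set} (f : A → B → C) xs ys →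
  concatMap (λ x → map (f x) ys) xs ≡ cartesianProductWith f xs ys
concatMap-map≡cartesianProductWith f []       ys = refl
concatMap-map≡cartesianProductWith f (x ∷ xs) ys = cong (map (f x) ys ++_) (concatMap-map≡cartesianProductWith f xs ys)

vecs-unique : ∀ n k → Unique (vecs n k)
vecs-unique n zero    = [] ∷ []
vecs-unique n (suc k) = subst Unique (sym (concatMap-map≡cartesianProductWith _∷_ (allFin n) (vecs n k)))
  (cartesianProductWith⁺ _∷_ ∷-injective (allFin⁺ n) (vecs-unique n k))

∈-vecs : ∀ n k (v : Vec (Fin n) k) → v ∈ vecs n k
∈-vecs n zero    []      = here refl
∈-vecs n (suc k) (a ∷ v) = subst (a ∷ v ∈_) (sym (concatMap-map≡cartesianProductWith _∷_ (allFin n) (vecs n k)))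
  (∈-cartesianProductWith⁺ _∷_ (∈-allFin a) (∈-vecs n k v))

module _ {A : Set} (P : A → Bool) where

  foldr-∧-true⇒ : ∀ xs → foldr (λ x b → P x ∧ b) true xs ≡ true → ∀ x → x ∈ xs → P x ≡ true
  foldr-∧-true⇒ (y ∷ ys) all-true x x∈ with P y in Py
  foldr-∧-true⇒ (y ∷ ys) all-true x (here refl) | true = Py
  foldr-∧-true⇒ (y ∷ ys) all-true x (there x∈) | true = foldr-∧-true⇒ ys all-true x x∈

  foldr-∧-true⇐ : ∀ xs → (∀ x → P x ≡ true) → foldr (λ x b → P x ∧ b) true xs ≡ true
  foldr-∧-true⇐ []       all-true = refl
  foldr-∧-true⇐ (y ∷ ys) all-true rewrite all-true y = foldr-∧-true⇐ ys all-true

module _ {n : ℕ} (P : Fin n → Bool) where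

  allᵇ-true⇒ : allᵇ P ≡ true → ∀ i → P i ≡ true
  allᵇ-true⇒ all-true i = foldr-∧-true⇒ P (allFin n) all-true i (∈-allFin i)

  allᵇ-true⇐ : (∀ i → P i ≡ true) → allᵇ P ≡ true
  allᵇ-true⇐ = foldr-∧-true⇐ P (allFin n)

module _ {n : ℕ} (a b : Fin n) where

  transpose-ˡ : transpose a b a ≡ b
  transpose-ˡ rewrite dec-true (a ≟ a) refl = refl

  transpose-ʳ : transpose a b b ≡ a
  transpose-ʳ with b ≟ a
  ... | yes b≡a = b≡a
  ... | no  _   rewrite dec-true (b ≟ b) refl = refl

  transpose-other : ∀ {x} → x ≢ a → x ≢ b → transpose a b x ≡ x
  transpose-other {x} x≢a x≢b rewrite dec-false (x ≟ a) x≢a | dec-false (x ≟ b) x≢b = refl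

  transpose-involutive : ∀ x → transpose a b (transpose a b x) ≡ x
  transpose-involutive x = by-cases (x ≟ a) (x ≟ b)
    where
    by-cases : Dec (x ≡ a) → Dec (x ≡ b) → transpose a b (transpose a b x) ≡ x
    by-cases (yes refl) _          = trans (cong (transpose a b) transpose-ˡ) transpose-ʳ
    by-cases (no _)     (yes refl) = trans (cong (transpose a b) transpose-ʳ) transpose-ˡ
    by-cases (no x≢a)   (no x≢b)   = trans (cong (transpose a b) (transpose-other x≢a x≢b)) (transpose-other x≢a x≢b)

  transpose-preserves : (P : Fin n → Set) → P a → P b → ∀ {x} → P x → P (transpose a b x)
  transpose-preserves P Pa Pb {x} Px = by-cases (x ≟ a) (x ≟ b)
    where
    by-cases : Dec (x ≡ a) → Dec (x ≡ b) → P (transpose a b x)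
    by-cases (yes refl) _          = subst P (sym transpose-ˡ) Pb
    by-cases (no _)     (yes refl) = subst P (sym transpose-ʳ) Pa
    by-cases (no x≢a)   (no x≢b)   = subst P (sym (transpose-other x≢a x≢b)) Px

swap : ∀ {n} → Map n → Fin n → Fin n → Map n
swap σ a b = Vec.tabulate (lookup σ ∘ transpose a b)

module _ {n : ℕ} (σ : Map n) (a b : Fin n) where

  lookup-swap : ∀ x → lookup (swap σ a b) x ≡ lookup σ (transpose a b x)
  lookup-swap = lookup∘tabulate (lookup σ ∘ transpose a b)

  lookup-swap-ˡ : lookup (swap σ a b) a ≡ lookup σ b
  lookup-swap-ˡ = trans (lookup-swap a) (cong (lookup σ) (transpose-ˡ a b))

  lookup-swap-ʳ : lookup (swap σ a b) b ≡ lookup σ a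
  lookup-swap-ʳ = trans (lookup-swap b) (cong (lookup σ) (transpose-ʳ a b))

  swap-involutive : swap (swap σ a b) a b ≡ σ
  swap-involutive = trans
    (tabulate-cong (λ x → trans (lookup-swap (transpose a b x)) (cong (lookup σ) (transpose-involutive a b x))))
    (tabulate∘lookup σ)

swap-injective : ∀ {n} (a b : Fin n) {σ τ : Map n} → swap σ a b ≡ swap τ a b → σ ≡ τ
swap-injective a b {σ} {τ} eq =
  trans (sym (swap-involutive σ a b)) (trans (cong (λ ρ → swap ρ a b) eq) (swap-involutive τ a b))

record IsBijection {n} (X Y : Subset n) (σ : Map n) : Set where
  field
    maps-into     : ∀ x → lookup X x ≡ true → lookup Y (lookup σ x) ≡ true
    fixes-outside : ∀ x → lookup X x ≡ false → lookup σ x ≡ x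
    injective-on  : ∀ x y → lookup X x ≡ true → lookup X y ≡ true → lookup σ x ≡ lookup σ y → x ≡ y

open IsBijection

module _ {n : ℕ} (X Y : Subset n) where

  isBij⇒IsBijection : ∀ σ → isBij X Y σ ≡ true → IsBijection X Y σ
  isBij⇒IsBijection σ isBijσ = record { maps-into = into ; fixes-outside = outside ; injective-on = injective }
    where
    graph : ∀ x → (if lookup X x then lookup Y (lookup σ x) else (lookup σ x == x)) ≡ true
    graph = allᵇ-true⇒ _ (proj₁ (∧-true⁻ isBijσ))

    into : ∀ x → lookup X x ≡ true → lookup Y (lookup σ x) ≡ true
    into x Xx with graph x
    ... | g rewrite Xx = g

    outside : ∀ x → lookup X x ≡ false → lookup σ x ≡ x
    outside x ¬Xx with graph x
    ... | g rewrite ¬Xx = ==⇒≡ g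

    injective : ∀ x y → lookup X x ≡ true → lookup X y ≡ true → lookup σ x ≡ lookup σ y → x ≡ y
    injective x y Xx Xy σx≡σy = ==⇒≡ (no-clash Xx Xy (trans (cong (lookup σ x ==_) (sym σx≡σy)) (==-refl (lookup σ x))) row-x)
      where
      row-x : (not (lookup X x ∧ lookup X y ∧ (lookup σ x == lookup σ y)) ∨ (x == y)) ≡ true
      row-x = allᵇ-true⇒ (λ j → not (lookup X x ∧ lookup X j ∧ (lookup σ x == lookup σ j)) ∨ (x == j))
                (allᵇ-true⇒ _ (proj₂ (∧-true⁻ isBijσ)) x) y
      no-clash : ∀ {a b c d} → a ≡ true → b ≡ true → c ≡ true → (not (a ∧ b ∧ c) ∨ d) ≡ true → d ≡ true
      no-clash refl refl refl d≡true = d≡true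

  IsBijection⇒isBij : ∀ σ → IsBijection X Y σ → isBij X Y σ ≡ true
  IsBijection⇒isBij σ bij = cong₂ _∧_ (allᵇ-true⇐ _ graph) (allᵇ-true⇐ _ (λ x → allᵇ-true⇐ _ (injective x)))
    where
    graph : ∀ x → (if lookup X x then lookup Y (lookup σ x) else (lookup σ x == x)) ≡ true
    graph x with lookup X x in Xx
    ... | true  = maps-into bij x Xx
    ... | false rewrite fixes-outside bij x Xx = ==-refl x

    injective : ∀ x y → (not (lookup X x ∧ lookup X y ∧ (lookup σ x == lookup σ y)) ∨ (x == y)) ≡ true
    injective x y with lookup X x in Xx | lookup X y in Xy
    ... | false | _     = refl
    ... | true  | false = refl
    ... | true  | true with lookup σ x == lookup σ y in σx==σy
    ...   | false = refl
    ...   | true rewrite injective-on bij x y Xx Xy (==⇒≡ σx==σy) = ==-refl y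

  ∈-bijections⁻ : ∀ {σ} → σ ∈ bijections X Y → IsBijection X Y σ
  ∈-bijections⁻ σ∈ = isBij⇒IsBijection _ (Equivalence.to T-≡ (proj₂ (∈-filter⁻ (T? ∘ isBij X Y) {xs = vecs n n} σ∈)))

  ∈-bijections⁺ : ∀ {σ} → IsBijection X Y σ → σ ∈ bijections X Y
  ∈-bijections⁺ {σ} bij = ∈-filter⁺ (T? ∘ isBij X Y) (∈-vecs n n σ) (Equivalence.from T-≡ (IsBijection⇒isBij σ bij))

  bijections-unique : Unique (bijections X Y)
  bijections-unique = filter⁺ (T? ∘ isBij X Y) {xs = vecs n n} (vecs-unique n n)

  All-IsBijection : All (IsBijection X Y) (bijections X Y)
  All-IsBijection = All.tabulate ∈-bijections⁻

  swap-IsBijection : ∀ {σ a b} → IsBijection X Y σ → lookup X a ≡ true → lookup X b ≡ true → IsBijection X Y (swap σ a b)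
  swap-IsBijection {σ} {a} {b} bij Xa Xb = record { maps-into = into ; fixes-outside = outside ; injective-on = injective }
    where
    X∋ : ∀ {x} → lookup X x ≡ true → lookup X (transpose a b x) ≡ true
    X∋ = transpose-preserves a b (λ x → lookup X x ≡ true) Xa Xb

    into : ∀ x → lookup X x ≡ true → lookup Y (lookup (swap σ a b) x) ≡ true
    into x Xx rewrite lookup-swap σ a b x = maps-into bij _ (X∋ Xx)

    outside : ∀ x → lookup X x ≡ false → lookup (swap σ a b) x ≡ x
    outside x ¬Xx = trans (lookup-swap σ a b x)
      (trans (cong (lookup σ) (transpose-other a b (λ { refl → true≢false Xa ¬Xx }) (λ { refl → true≢false Xb ¬Xx })))
             (fixes-outside bij x ¬Xx))
      where
      true≢false : ∀ {c} → c ≡ true → c ≡ false → ⊥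
      true≢false refl ()

    injective : ∀ x y → lookup X x ≡ true → lookup X y ≡ true → lookup (swap σ a b) x ≡ lookup (swap σ a b) y → x ≡ y
    injective x y Xx Xy eq rewrite lookup-swap σ a b x | lookup-swap σ a b y =
      trans (sym (transpose-involutive a b x))
        (trans (cong (transpose a b) (injective-on bij _ _ (X∋ Xx) (X∋ Xy) eq)) (transpose-involutive a b y))

  ∑-bijections-swap : ∀ {a b} → lookup X a ≡ true → lookup X b ≡ true → (g : Map n → ℕ) →
                      ∑ (bijections X Y) (λ σ → g (swap σ a b)) ≡ ∑ (bijections X Y) g
  ∑-bijections-swap {a} {b} Xa Xb g = trans (sym (∑-map (λ σ → swap σ a b) (bijections X Y) g))
    (∑-same-members (≡-dec _≟_) (map (λ σ → swap σ a b) (bijections X Y)) (bijections X Y) g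
      (map⁺ (swap-injective a b) bijections-unique) bijections-unique
      (λ τ τ∈ → let (σ , σ∈ , τ≡) = ∈-map⁻ (λ σ → swap σ a b) τ∈ in
        subst (_∈ bijections X Y) (sym τ≡) (swapped σ∈))
      (λ τ τ∈ → subst (_∈ map (λ σ → swap σ a b) (bijections X Y)) (swap-involutive τ a b)
        (∈-map⁺ (λ σ → swap σ a b) (swapped τ∈))))
    where
    swapped : ∀ {σ} → σ ∈ bijections X Y → swap σ a b ∈ bijections X Y
    swapped σ∈ = ∈-bijections⁺ (swap-IsBijection (∈-bijections⁻ σ∈) Xa Xb)

count-∧-not : ∀ {n} (P Q : Fin n → Bool) → count (λ x → P x ∧ Q x) + count (λ x → P x ∧ not (Q x)) ≡ count P
count-∧-not {n} P Q = trans (sym (∑-+ (allFin n) _ _)) (∑-cong (allFin n) (λ x → split (P x) (Q x)))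
  where
  split : ∀ p q → 𝟙 (p ∧ q) + 𝟙 (p ∧ not q) ≡ 𝟙 p
  split true  true  = refl
  split true  false = refl
  split false _     = refl

module _ {n : ℕ} {X Y : Subset n} {σ : Map n} (bij : IsBijection X Y σ) where

  private
    fibre-≤ : ∀ y → count (λ x → lookup X x ∧ (lookup σ x == y)) ≤ 𝟙 (lookup Y y)
    fibre-≤ y with lookup Y y in Yy
    ... | true  = count≤1 n _ (λ x x′ hit hit′ →
      injective-on bij x x′ (∧-true⁻ hit .proj₁) (∧-true⁻ hit′ .proj₁)
        (trans (==⇒≡ (∧-true⁻ hit .proj₂)) (sym (==⇒≡ (∧-true⁻ hit′ .proj₂)))))
    ... | false = ≤-reflexive (∑-zero (allFin n) miss)
      where
      miss : ∀ x → 𝟙 (lookup X x ∧ (lookup σ x == y)) ≡ 0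
      miss x with lookup X x in Xx | lookup σ x == y in σx==y
      ... | false | _     = refl
      ... | true  | false = refl
      ... | true  | true with () ← trans (sym (subst (λ z → lookup Y z ≡ true) (==⇒≡ σx==y) (maps-into bij x Xx))) Yy

    reindex : ∀ q c a → 𝟙 c * 𝟙 (a ∧ q) ≡ 𝟙 q * 𝟙 (a ∧ c)
    reindex q c true  = *-comm (𝟙 c) (𝟙 q)
    reindex q c false = trans (*-zeroʳ (𝟙 c)) (sym (*-zeroʳ (𝟙 q)))

  count-∘-bijection-≤ : (Q : Fin n → Bool) →
    count (λ x → lookup X x ∧ Q (lookup σ x)) ≤ count (λ y → lookup Y y ∧ Q y)
  count-∘-bijection-≤ Q = begin
    ∑[ x < n ] 𝟙 (lookup X x ∧ Q (lookup σ x))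
      ≡⟨ ∑-cong (allFin n) (λ x → sym (∑-δ n (lookup σ x) (λ y → 𝟙 (lookup X x ∧ Q y)))) ⟩
    ∑[ x < n ] (∑[ y < n ] 𝟙 (lookup σ x == y) * 𝟙 (lookup X x ∧ Q y))
      ≡⟨ ∑-swap (allFin n) (allFin n) (λ x y → 𝟙 (lookup σ x == y) * 𝟙 (lookup X x ∧ Q y)) ⟩
    ∑[ y < n ] (∑[ x < n ] 𝟙 (lookup σ x == y) * 𝟙 (lookup X x ∧ Q y))
      ≡⟨ ∑-cong (allFin n) (λ y → trans (∑-cong (allFin n) (λ x → reindex (Q y) _ (lookup X x)))
                                        (∑-*ˡ (allFin n) (𝟙 (Q y)) (λ x → 𝟙 (lookup X x ∧ (lookup σ x == y))))) ⟩
    ∑[ y < n ] 𝟙 (Q y) * count (λ x → lookup X x ∧ (lookup σ x == y))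
      ≤⟨ ∑-mono (allFin n) (λ y → *-monoʳ-≤ (𝟙 (Q y)) (fibre-≤ y)) ⟩
    ∑[ y < n ] 𝟙 (Q y) * 𝟙 (lookup Y y)
      ≡⟨ ∑-cong (allFin n) (λ y → trans (*-comm (𝟙 (Q y)) _) (sym (𝟙-∧ (lookup Y y) (Q y)))) ⟩
    ∑[ y < n ] 𝟙 (lookup Y y ∧ Q y)
      ∎
    where open ≤-Reasoning

  -- Apply the inequality to Q and to not ∘ Q; the two left sides add up to |X| = |Y|.
  count-∘-bijection : count (lookup X) ≡ count (lookup Y) → (Q : Fin n → Bool) →
    count (λ x → lookup X x ∧ Q (lookup σ x)) ≡ count (λ y → lookup Y y ∧ Q y)
  count-∘-bijection |X|≡|Y| Q = ≤-antisym (count-∘-bijection-≤ Q) (+-cancelʳ-≤ _ _ _ ≥)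
    where
    ≥ : count (λ y → lookup Y y ∧ Q y) + count (λ y → lookup Y y ∧ not (Q y))
      ≤ count (λ x → lookup X x ∧ Q (lookup σ x)) + count (λ y → lookup Y y ∧ not (Q y))
    ≥ = begin
      count (λ y → lookup Y y ∧ Q y) + count (λ y → lookup Y y ∧ not (Q y))
        ≡⟨ trans (count-∧-not (lookup Y) Q) (trans (sym |X|≡|Y|) (sym (count-∧-not (lookup X) (Q ∘ lookup σ)))) ⟩
      count (λ x → lookup X x ∧ Q (lookup σ x)) + count (λ x → lookup X x ∧ not (Q (lookup σ x)))
        ≤⟨ +-monoʳ-≤ _ (count-∘-bijection-≤ (not ∘ Q)) ⟩
      count (λ x → lookup X x ∧ Q (lookup σ x)) + count (λ y → lookup Y y ∧ not (Q y))
        ∎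
      where open ≤-Reasoning

Injects : ∀ {n} → (Fin n → Bool) → (Fin n → Bool) → (Fin n → Fin n) → Set
Injects P R f = (∀ x → P x ≡ true → R (f x) ≡ true) × (∀ x y → P x ≡ true → P y ≡ true → f x ≡ f y → x ≡ y)

∃-injection : ∀ {n} c (P R : Fin n → Bool) → count P ≡ c → c ≤ count R → ∃ (Injects P R)
∃-injection {n} zero P R |P|≡0 _ = (λ x → x) , (λ x Px → absurd Px) , (λ x _ Px _ _ → absurd Px)
  where
  absurd : ∀ {x} {A : Set} → P x ≡ true → A
  absurd {x} Px with () ← trans (sym Px) (count≡0 n P |P|≡0 x)
∃-injection {n} (suc c) P R |P|≡1+c 1+c≤|R| = f , into , injective
  where
  inhabited : ∀ (Q : Fin n → Bool) → 0 < count Q → ∃ λ x → Q x ≡ true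
  inhabited Q |Q|>0 = ∑-𝟙≢0⇒∃ (allFin n) Q (m<n⇒n≢0 |Q|>0)

  x₀∈P : ∃ λ x → P x ≡ true
  x₀∈P = inhabited P (≤-trans (s≤s z≤n) (≤-reflexive (sym |P|≡1+c)))

  y₀∈R : ∃ λ y → R y ≡ true
  y₀∈R = inhabited R (≤-trans (s≤s z≤n) 1+c≤|R|)

  x₀ y₀ : Fin n
  x₀ = proj₁ x₀∈P
  y₀ = proj₁ y₀∈R

  P′ R′ : Fin n → Bool
  P′ x = P x ∧ not (x₀ == x)
  R′ y = R y ∧ not (y₀ == y)

  smaller : ∃ (Injects P′ R′)
  smaller = ∃-injection c P′ R′
    (suc-injective (trans (sym (count-remove P x₀ (proj₂ x₀∈P))) |P|≡1+c))
    (s≤s⁻¹ (subst (suc c ≤_) (count-remove R y₀ (proj₂ y₀∈R)) 1+c≤|R|))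

  f′ : Fin n → Fin n
  f′ = proj₁ smaller

  f : Fin n → Fin n
  f x = if x == x₀ then y₀ else f′ x

  P′-intro : ∀ {x} → P x ≡ true → (x == x₀) ≡ false → P′ x ≡ true
  P′-intro {x} Px x≠x₀ rewrite Px | ==-sym x₀ x | x≠x₀ = refl

  into : ∀ x → P x ≡ true → R (f x) ≡ true
  into x Px with x == x₀ in x=x₀
  ... | true  = proj₂ y₀∈R
  ... | false = proj₁ (∧-true⁻ (proj₁ (proj₂ smaller) x (P′-intro Px x=x₀)))

  y₀≢f′ : ∀ {x} → P x ≡ true → (x == x₀) ≡ false → y₀ ≢ f′ x
  y₀≢f′ {x} Px x≠x₀ y₀≡f′x = not-true y₀≠f′x (trans (cong (y₀ ==_) (sym y₀≡f′x)) (==-refl y₀))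
    where
    y₀≠f′x : not (y₀ == f′ x) ≡ true
    y₀≠f′x = proj₂ (∧-true⁻ {R (f′ x)} (proj₁ (proj₂ smaller) x (P′-intro Px x≠x₀)))
    not-true : ∀ {b} → not b ≡ true → b ≡ true → ⊥
    not-true () refl

  injective : ∀ x y → P x ≡ true → P y ≡ true → f x ≡ f y → x ≡ y
  injective x y Px Py fx≡fy with x == x₀ in x=x₀ | y == x₀ in y=x₀
  ... | true  | true  = trans (==⇒≡ x=x₀) (sym (==⇒≡ y=x₀))
  ... | true  | false = ⊥-elim (y₀≢f′ Py y=x₀ fx≡fy)
  ... | false | true  = ⊥-elim (y₀≢f′ Px x=x₀ (sym fx≡fy))
  ... | false | false = proj₂ (proj₂ smaller) x y (P′-intro Px x=x₀) (P′-intro Py y=x₀) fx≡fy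

module _ {n : ℕ} (X Y : Subset n) (|X|≡|Y| : count (lookup X) ≡ count (lookup Y)) where

  ∃-bijection : ∃ (IsBijection X Y)
  ∃-bijection = σ , record { maps-into = into ; fixes-outside = outside ; injective-on = injective }
    where
    injection : ∃ (Injects (lookup X) (lookup Y))
    injection = ∃-injection (count (lookup X)) (lookup X) (lookup Y) refl (≤-reflexive |X|≡|Y|)

    f : Fin n → Fin n
    f = proj₁ injection

    σ : Map n
    σ = Vec.tabulate (λ x → if lookup X x then f x else x)

    lookup-σ : ∀ x → lookup σ x ≡ (if lookup X x then f x else x)
    lookup-σ = lookup∘tabulate _

    into : ∀ x → lookup X x ≡ true → lookup Y (lookup σ x) ≡ true
    into x Xx rewrite lookup-σ x | Xx = proj₁ (proj₂ injection) x Xx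

    outside : ∀ x → lookup X x ≡ false → lookup σ x ≡ x
    outside x ¬Xx rewrite lookup-σ x | ¬Xx = refl

    injective : ∀ x y → lookup X x ≡ true → lookup X y ≡ true → lookup σ x ≡ lookup σ y → x ≡ y
    injective x y Xx Xy σx≡σy rewrite lookup-σ x | lookup-σ y | Xx | Xy = proj₂ (proj₂ injection) x y Xx Xy σx≡σy

  bijections-nonempty : 1 ≤ length (bijections X Y)
  bijections-nonempty with bijections X Y | ∈-bijections⁺ X Y (proj₂ ∃-bijection)
  ... | _ ∷ _ | _ = s≤s z≤n

-- Diagonals

∑-split-at-two : ∀ n {a b : Fin n} → a ≢ b → (f : Fin n → ℕ) →
  ∑Fin n f ≡ f a + (f b + (∑[ x < n ] 𝟙 (not (a == x)) * (𝟙 (not (b == x)) * f x)))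
∑-split-at-two n {a} {b} a≢b f = begin
  ∑Fin n f
    ≡⟨ ∑-split-at n a f ⟩
  f a + (∑[ x < n ] 𝟙 (not (a == x)) * f x)
    ≡⟨ cong (f a +_) (∑-split-at n b (λ x → 𝟙 (not (a == x)) * f x)) ⟩
  f a + (𝟙 (not (a == b)) * f b + (∑[ x < n ] 𝟙 (not (b == x)) * (𝟙 (not (a == x)) * f x)))
    ≡⟨ cong (λ c → f a + (𝟙 (not c) * f b + (∑[ x < n ] 𝟙 (not (b == x)) * (𝟙 (not (a == x)) * f x)))) (==-≢ a≢b) ⟩
  f a + ((f b + 0) + (∑[ x < n ] 𝟙 (not (b == x)) * (𝟙 (not (a == x)) * f x)))
    ≡⟨ cong₂ (λ u v → f a + (u + v)) (+-identityʳ (f b)) (∑-cong (allFin n) (λ x → x*[y*z]≡y*[x*z] (𝟙 (not (b == x))) (𝟙 (not (a == x))) (f x))) ⟩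
  f a + (f b + (∑[ x < n ] 𝟙 (not (a == x)) * (𝟙 (not (b == x)) * f x)))
    ∎
  where open ≡-Reasoning

∑-exchange-two : ∀ n {a b : Fin n} → a ≢ b → (f g : Fin n → ℕ) → (∀ x → x ≢ a → x ≢ b → f x ≡ g x) →
  ∑Fin n f + (g a + g b) ≡ ∑Fin n g + (f a + f b)
∑-exchange-two n {a} {b} a≢b f g agree = begin
  ∑Fin n f + (g a + g b)                  ≡⟨ cong (_+ (g a + g b)) (∑-split-at-two n a≢b f) ⟩
  (f a + (f b + rest f)) + (g a + g b)    ≡⟨ cong (λ r → (f a + (f b + r)) + (g a + g b)) rest-agree ⟩
  (f a + (f b + rest g)) + (g a + g b)    ≡⟨ solve-∀-exchange (f a) (f b) (rest g) (g a) (g b) ⟩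
  (g a + (g b + rest g)) + (f a + f b)    ≡⟨ cong (_+ (f a + f b)) (∑-split-at-two n a≢b g) ⟨
  ∑Fin n g + (f a + f b)                  ∎
  where
  open ≡-Reasoning
  rest : (Fin n → ℕ) → ℕ
  rest h = ∑[ x < n ] 𝟙 (not (a == x)) * (𝟙 (not (b == x)) * h x)

  rest-agree : rest f ≡ rest g
  rest-agree = ∑-cong (allFin n) pointwise
    where
    pointwise : ∀ x → 𝟙 (not (a == x)) * (𝟙 (not (b == x)) * f x) ≡ 𝟙 (not (a == x)) * (𝟙 (not (b == x)) * g x)
    pointwise x with a ≟ x | b ≟ x
    ... | yes _   | _       = refl
    ... | no  _   | yes _   = refl
    ... | no  a≢x | no  b≢x = cong (λ v → 1 * (1 * v)) (agree x (a≢x ∘ sym) (b≢x ∘ sym))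

  solve-∀-exchange : ∀ fa fb r ga gb → (fa + (fb + r)) + (ga + gb) ≡ (ga + (gb + r)) + (fa + fb)
  solve-∀-exchange = solve-∀

largeOnDiagonal : ∀ {n} → (Fin n → Fin n → Bool) → Subset n → Map n → ℕ
largeOnDiagonal L X σ = count (λ x → lookup X x ∧ L x (lookup σ x))

module _ {n : ℕ} (L : Fin n → Fin n → Bool) (X : Subset n) where

  private
    countFin≡largeOnDiagonal : ∀ σ → countFin (λ x → lookup X x ∧ L x (lookup σ x)) ≡ largeOnDiagonal L X σ
    countFin≡largeOnDiagonal σ = countFin≡count (λ x → lookup X x ∧ L x (lookup σ x))

  isGoodDiag-true⇒ : ∀ σ → isGoodDiag L X σ ≡ true → largeOnDiagonal L X σ ≡ 1
  isGoodDiag-true⇒ σ good =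
    ≡ᵇ⇒≡ _ 1 (Equivalence.from T-≡ (trans (sym (cong (_≡ᵇ 1) (countFin≡largeOnDiagonal σ))) good))

  isGoodDiag-false⇐ : ∀ σ → 2 ≤ largeOnDiagonal L X σ → isGoodDiag L X σ ≡ false
  isGoodDiag-false⇐ σ ≥2 = trans (cong (_≡ᵇ 1) (countFin≡largeOnDiagonal σ)) (≥2⇒≢ᵇ1 ≥2)
    where
    ≥2⇒≢ᵇ1 : ∀ {d} → 2 ≤ d → (d ≡ᵇ 1) ≡ false
    ≥2⇒≢ᵇ1 (s≤s (s≤s _)) = refl

  -- Switching at x₁, x₂ trades the diagonal entries (x₁, σ x₁), (x₂, σ x₂) for (x₁, σ x₂), (x₂, σ x₁);
  -- σ keeps the large entry of the switched diagonal and has the large entry at x₁ besides.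
  swap-good⇒bad : ∀ σ {x₁ x₂} → lookup X x₁ ≡ true → lookup X x₂ ≡ true → x₁ ≢ x₂ →
    L x₁ (lookup σ x₁) ≡ true → L x₁ (lookup σ x₂) ≡ false → L x₂ (lookup σ x₁) ≡ false →
    isGoodDiag L X (swap σ x₁ x₂) ≡ true → isGoodDiag L X σ ≡ false
  swap-good⇒bad σ {x₁} {x₂} Xx₁ Xx₂ x₁≢x₂ old-large new₁-small new₂-small good′ =
    isGoodDiag-false⇐ σ (≤-trans (m≤m+n 2 (𝟙 (L x₂ (lookup σ x₂)))) (≤-reflexive (sym exchange)))
    where
    diag : Map n → Fin n → ℕ
    diag τ x = 𝟙 (lookup X x ∧ L x (lookup τ x))

    exchange : largeOnDiagonal L X σ ≡ 2 + 𝟙 (L x₂ (lookup σ x₂))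
    exchange = begin
      largeOnDiagonal L X σ
        ≡⟨ trans (cong (largeOnDiagonal L X σ +_) (cong₂ _+_ new-small₁ new-small₂)) (+-identityʳ _) ⟨
      largeOnDiagonal L X σ + (diag σ′ x₁ + diag σ′ x₂)
        ≡⟨ ∑-exchange-two n x₁≢x₂ (diag σ) (diag σ′) unchanged ⟩
      largeOnDiagonal L X σ′ + (diag σ x₁ + diag σ x₂)
        ≡⟨ cong₂ (λ d e → d + (e + diag σ x₂)) (isGoodDiag-true⇒ σ′ good′) (trans (cong (λ b → 𝟙 (b ∧ _)) Xx₁) (cong 𝟙 old-large)) ⟩
      2 + diag σ x₂
        ≡⟨ cong (λ b → 2 + 𝟙 (b ∧ L x₂ (lookup σ x₂))) Xx₂ ⟩
      2 + 𝟙 (L x₂ (lookup σ x₂))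
        ∎
      where
      open ≡-Reasoning
      σ′ : Map n
      σ′ = swap σ x₁ x₂
      new-small₁ : diag σ′ x₁ ≡ 0
      new-small₁ = cong 𝟙 (cong₂ _∧_ Xx₁ (trans (cong (L x₁) (lookup-swap-ˡ σ x₁ x₂)) new₁-small))
      new-small₂ : diag σ′ x₂ ≡ 0
      new-small₂ = cong 𝟙 (cong₂ _∧_ Xx₂ (trans (cong (L x₂) (lookup-swap-ʳ σ x₁ x₂)) new₂-small))
      unchanged : ∀ x → x ≢ x₁ → x ≢ x₂ → diag σ x ≡ diag σ′ x
      unchanged x x≢x₁ x≢x₂ = cong (λ y → 𝟙 (lookup X x ∧ L x y))
        (sym (trans (lookup-swap σ x₁ x₂ x) (cong (lookup σ) (transpose-other x₁ x₂ x≢x₁ x≢x₂))))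

-- The switching argument

module Pairs {n : ℕ} (X Y : Subset n) where

  distinct : Fin n → Fin n → ℕ
  distinct x₁ x₂ = 𝟙 (lookup X x₁ ∧ lookup X x₂ ∧ not (x₁ == x₂))

  ∑pairs : (Fin n → Fin n → ℕ) → ℕ
  ∑pairs g = ∑[ x₁ < n ] (∑[ x₂ < n ] distinct x₁ x₂ * g x₁ x₂)

  ∑switches : (Map n → Fin n → Fin n → ℕ) → ℕ
  ∑switches h = ∑ (bijections X Y) (λ σ → ∑pairs (h σ))

  private
    ∑switches-inside : (F : Map n → Fin n → Fin n → ℕ) →
      ∑ (bijections X Y) (λ σ → ∑[ x₁ < n ] (∑[ x₂ < n ] F σ x₁ x₂))
        ≡ ∑[ x₁ < n ] (∑[ x₂ < n ] ∑ (bijections X Y) (λ σ → F σ x₁ x₂))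
    ∑switches-inside F = trans (∑-swap (bijections X Y) (allFin n) (λ σ x₁ → ∑[ x₂ < n ] F σ x₁ x₂))
      (∑-cong (allFin n) (λ x₁ → ∑-swap (bijections X Y) (allFin n) (λ σ x₂ → F σ x₁ x₂)))

    swap-at-pair : (h : Map n → Fin n → Fin n → ℕ) → ∀ x₁ x₂ →
      ∑ (bijections X Y) (λ σ → distinct x₁ x₂ * h (swap σ x₁ x₂) x₁ x₂) ≡ ∑ (bijections X Y) (λ σ → distinct x₁ x₂ * h σ x₁ x₂)
    swap-at-pair h x₁ x₂ = trans (∑-*ˡ (bijections X Y) (distinct x₁ x₂) _)
      (trans (by-cases (lookup X x₁) (lookup X x₂) refl refl) (sym (∑-*ˡ (bijections X Y) (distinct x₁ x₂) _)))
      where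
      by-cases : ∀ a b → lookup X x₁ ≡ a → lookup X x₂ ≡ b →
        distinct x₁ x₂ * ∑ (bijections X Y) (λ σ → h (swap σ x₁ x₂) x₁ x₂) ≡ distinct x₁ x₂ * ∑ (bijections X Y) (λ σ → h σ x₁ x₂)
      by-cases true  true  Xx₁ Xx₂ = cong (distinct x₁ x₂ *_) (∑-bijections-swap X Y Xx₁ Xx₂ (λ σ → h σ x₁ x₂))
      by-cases false _     Xx₁ Xx₂ rewrite Xx₁ = refl
      by-cases true  false Xx₁ Xx₂ rewrite Xx₁ | Xx₂ = refl

  -- Switching σ ↦ σ ∘ (x₁ x₂) at a fixed pair permutes the bijections X → Y.
  ∑switches-swap : (h : Map n → Fin n → Fin n → ℕ) → ∑switches (λ σ x₁ x₂ → h (swap σ x₁ x₂) x₁ x₂) ≡ ∑switches h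
  ∑switches-swap h = trans (∑switches-inside (λ σ x₁ x₂ → distinct x₁ x₂ * h (swap σ x₁ x₂) x₁ x₂))
    (trans (∑-cong (allFin n) (λ x₁ → ∑-cong (allFin n) (swap-at-pair h x₁)))
      (sym (∑switches-inside (λ σ x₁ x₂ → distinct x₁ x₂ * h σ x₁ x₂))))

  ∑switches-flip : (h : Map n → Fin n → Fin n → ℕ) → ∑switches (λ σ x₁ x₂ → h σ x₂ x₁) ≡ ∑switches h
  ∑switches-flip h = ∑-cong (bijections X Y) (λ σ →
    trans (∑-swap (allFin n) (allFin n) (λ x₁ x₂ → distinct x₁ x₂ * h σ x₂ x₁))
      (∑-cong (allFin n) (λ a → ∑-cong (allFin n) (λ b → cong (_* h σ a b) (distinct-sym b a)))))
    where
    distinct-sym : ∀ x₁ x₂ → distinct x₁ x₂ ≡ distinct x₂ x₁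
    distinct-sym x₁ x₂ rewrite ==-sym x₁ x₂ = cong 𝟙 (∧-swap (lookup X x₁) (lookup X x₂) _)
      where
      ∧-swap : ∀ a b c → (a ∧ b ∧ c) ≡ (b ∧ a ∧ c)
      ∧-swap a b c = trans (sym (∧-assoc a b c)) (trans (cong (_∧ c) (∧-comm a b)) (∧-assoc b a c))

  ∑switches-swap-flip : (h : Map n → Fin n → Fin n → ℕ) → ∑switches (λ σ x₁ x₂ → h (swap σ x₁ x₂) x₂ x₁) ≡ ∑switches h
  ∑switches-swap-flip h = trans (∑switches-swap (λ σ x₁ x₂ → h σ x₂ x₁)) (∑switches-flip h)

  elsewhere : Fin n → Fin n → ℕ
  elsewhere x₁ x = 𝟙 (lookup X x ∧ not (x₁ == x))

  elsewhere-*-≤ : ∀ x₁ x {a b} → (lookup X x ≡ true → x₁ ≢ x → a ≤ b) → elsewhere x₁ x * a ≤ elsewhere x₁ x * b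
  elsewhere-*-≤ x₁ x a≤b with lookup X x | x₁ ≟ x
  ... | false | _        = z≤n
  ... | true  | yes _    = z≤n
  ... | true  | no x₁≢x  = *-monoʳ-≤ 1 (a≤b refl x₁≢x)

  count-split-at : ∀ x₁ (Q : Fin n → Bool) →
    count (λ x → lookup X x ∧ Q x) ≡ 𝟙 (lookup X x₁ ∧ Q x₁) + (∑[ x < n ] elsewhere x₁ x * 𝟙 (Q x))
  count-split-at x₁ Q = trans (∑-split-at n x₁ (λ x → 𝟙 (lookup X x ∧ Q x)))
    (cong (𝟙 (lookup X x₁ ∧ Q x₁) +_) (∑-cong (allFin n) (λ x → 𝟙-not-∧ (x₁ == x) (lookup X x) (Q x))))

  count-elsewhere-≡ : ∀ x₁ (Q : Fin n → Bool) → Q x₁ ≡ false →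
    ∑[ x < n ] elsewhere x₁ x * 𝟙 (Q x) ≡ count (λ x → lookup X x ∧ Q x)
  count-elsewhere-≡ x₁ Q Qx₁≡false = sym (trans (count-split-at x₁ Q)
    (cong (λ b → 𝟙 b + (∑[ x < n ] elsewhere x₁ x * 𝟙 (Q x))) (trans (cong (lookup X x₁ ∧_) Qx₁≡false) (∧-zeroʳ (lookup X x₁)))))

  ∑-elsewhere : ∀ {x₁} m₁ → lookup X x₁ ≡ true → count (lookup X) ≡ suc m₁ → ∑[ x < n ] elsewhere x₁ x * 1 ≡ m₁
  ∑-elsewhere {x₁} m₁ Xx₁ |X|≡1+m₁ = suc-injective (begin
    suc (∑[ x < n ] elsewhere x₁ x * 1)                         ≡⟨ cong (λ b → 𝟙 (b ∧ true) + (∑[ x < n ] elsewhere x₁ x * 1)) Xx₁ ⟨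
    𝟙 (lookup X x₁ ∧ true) + (∑[ x < n ] elsewhere x₁ x * 1)    ≡⟨ count-split-at x₁ (λ _ → true) ⟨
    count (λ x → lookup X x ∧ true)                            ≡⟨ ∑-cong (allFin n) (λ x → cong 𝟙 (∧-identityʳ (lookup X x))) ⟩
    count (lookup X)                                           ≡⟨ |X|≡1+m₁ ⟩
    suc m₁                                                     ∎)
    where open ≡-Reasoning

  ∑pairs-cong : ∀ {g g′ : Fin n → Fin n → ℕ} → (∀ x₁ x₂ → g x₁ x₂ ≡ g′ x₁ x₂) → ∑pairs g ≡ ∑pairs g′
  ∑pairs-cong g≗g′ = ∑-cong (allFin n) (λ x₁ → ∑-cong (allFin n) (λ x₂ → cong (distinct x₁ x₂ *_) (g≗g′ x₁ x₂)))

  ∑pairs-mono : {g g′ : Fin n → Fin n → ℕ} →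
    (∀ x₁ x₂ → lookup X x₁ ≡ true → lookup X x₂ ≡ true → x₁ ≢ x₂ → g x₁ x₂ ≤ g′ x₁ x₂) → ∑pairs g ≤ ∑pairs g′
  ∑pairs-mono {g} {g′} g≤g′ = ∑-mono (allFin n) (λ x₁ → ∑-mono (allFin n) (λ x₂ →
    𝟙-*-≤ (lookup X x₁ ∧ lookup X x₂ ∧ not (x₁ == x₂)) (within x₁ x₂)))
    where
    within : ∀ x₁ x₂ → (lookup X x₁ ∧ lookup X x₂ ∧ not (x₁ == x₂)) ≡ true → g x₁ x₂ ≤ g′ x₁ x₂
    within x₁ x₂ both with ∧-true⁻ {lookup X x₁} both
    ... | Xx₁ , rest with ∧-true⁻ {lookup X x₂} rest
    ...   | Xx₂ , x₁≠x₂ = g≤g′ x₁ x₂ Xx₁ Xx₂ (λ { refl → true≢false (trans (sym (==-refl x₁)) (not-true⇒false x₁≠x₂)) })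
      where
      true≢false : true ≢ false
      true≢false ()

  ∑pairs-factor : (a : Fin n → Bool) (Q : Fin n → Fin n → ℕ) →
    ∑pairs (λ x₁ x₂ → 𝟙 (a x₁) * Q x₁ x₂) ≡ ∑[ x₁ < n ] 𝟙 (lookup X x₁ ∧ a x₁) * (∑[ x₂ < n ] elsewhere x₁ x₂ * Q x₁ x₂)
  ∑pairs-factor a Q = ∑-cong (allFin n) (λ x₁ →
    trans (∑-cong (allFin n) (λ x₂ → regroup x₁ x₂)) (∑-*ˡ (allFin n) (𝟙 (lookup X x₁ ∧ a x₁)) (λ x₂ → elsewhere x₁ x₂ * Q x₁ x₂)))
    where
    regroup : ∀ x₁ x₂ → distinct x₁ x₂ * (𝟙 (a x₁) * Q x₁ x₂) ≡ 𝟙 (lookup X x₁ ∧ a x₁) * (elsewhere x₁ x₂ * Q x₁ x₂)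
    regroup x₁ x₂ = begin
      distinct x₁ x₂ * (𝟙 (a x₁) * Q x₁ x₂)                       ≡⟨ cong (_* (𝟙 (a x₁) * Q x₁ x₂)) (𝟙-∧ (lookup X x₁) _) ⟩
      (𝟙 (lookup X x₁) * elsewhere x₁ x₂) * (𝟙 (a x₁) * Q x₁ x₂)  ≡⟨ [m*n]*[o*p]≡[m*o]*[n*p] (𝟙 (lookup X x₁)) _ _ _ ⟩
      (𝟙 (lookup X x₁) * 𝟙 (a x₁)) * (elsewhere x₁ x₂ * Q x₁ x₂)  ≡⟨ cong (_* (elsewhere x₁ x₂ * Q x₁ x₂)) (𝟙-∧ (lookup X x₁) (a x₁)) ⟨
      𝟙 (lookup X x₁ ∧ a x₁) * (elsewhere x₁ x₂ * Q x₁ x₂)        ∎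
      where open ≡-Reasoning

  -- The 1 accounts for the unique large entry of σ, which is not at x₁.
  ∑-elsewhere-≤-good : (L : Fin n → Fin n → Bool) (σ : Map n) {x₁ : Fin n} (e : Fin n → Bool) →
    lookup X x₁ ≡ true → L x₁ (lookup σ x₁) ≡ false → isGoodDiag L X σ ≡ true →
    ∑[ x < n ] elsewhere x₁ x * 𝟙 (e x) ≤ (∑[ x < n ] elsewhere x₁ x * 𝟙 (e x ∧ not (L x (lookup σ x)))) + 1
  ∑-elsewhere-≤-good L σ {x₁} e Xx₁ small good = begin
    ∑[ x < n ] elsewhere x₁ x * 𝟙 (e x)
      ≤⟨ ∑-mono (allFin n) (λ x → ≤-trans (*-monoʳ-≤ (elsewhere x₁ x) (cover (e x) (d x))) (≤-reflexive (*-distribˡ-+ (elsewhere x₁ x) _ _))) ⟩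
    ∑[ x < n ] (elsewhere x₁ x * 𝟙 (e x ∧ not (d x)) + elsewhere x₁ x * 𝟙 (d x))
      ≡⟨ ∑-+ (allFin n) (λ x → elsewhere x₁ x * 𝟙 (e x ∧ not (d x))) (λ x → elsewhere x₁ x * 𝟙 (d x)) ⟩
    (∑[ x < n ] elsewhere x₁ x * 𝟙 (e x ∧ not (d x))) + (∑[ x < n ] elsewhere x₁ x * 𝟙 (d x))
      ≡⟨ cong ((∑[ x < n ] elsewhere x₁ x * 𝟙 (e x ∧ not (d x))) +_) one-large-elsewhere ⟩
    (∑[ x < n ] elsewhere x₁ x * 𝟙 (e x ∧ not (d x))) + 1
      ∎
    where
    open ≤-Reasoning
    d : Fin n → Bool
    d x = L x (lookup σ x)

    cover : ∀ p q → 𝟙 p ≤ 𝟙 (p ∧ not q) + 𝟙 q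
    cover true  true  = s≤s z≤n
    cover true  false = s≤s z≤n
    cover false q     = z≤n

    one-large-elsewhere : ∑[ x < n ] elsewhere x₁ x * 𝟙 (d x) ≡ 1
    one-large-elsewhere = trans (cong (λ b → 𝟙 b + (∑[ x < n ] elsewhere x₁ x * 𝟙 (d x))) (sym (cong₂ _∧_ Xx₁ small)))
      (trans (sym (count-split-at x₁ d)) (isGoodDiag-true⇒ L X σ good))

-- For a line with k large entries in the restriction: small σ and large σ indicate whether the
-- diagonal σ meets the line in a small or a large entry.
record SwitchingCounts {n} (L : Fin n → Fin n → Bool) (X Y : Subset n) (k : ℕ) : Set where
  field
    k′ m₁         : ℕ
    small large   : Map n → ℕ
    small+large≡1 : ∀ σ → IsBijection X Y σ → small σ + large σ ≡ 1
    k+k′≡|X|      : k + k′ ≡ sizeOf X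
    |X|≡1+m₁      : sizeOf X ≡ suc m₁
    balanced      : ∑ (bijections X Y) (λ σ → small σ * k) ≡ ∑ (bijections X Y) (λ σ → large σ * k′)
    switching     : ∑ (bijections X Y) (λ σ → (small σ * 𝟙 (isGoodDiag L X σ)) * k)
                  ≤ ∑ (bijections X Y) (λ σ → (large σ * 𝟙 (not (isGoodDiag L X σ))) * m₁)
                    + ∑ (bijections X Y) (λ σ → small σ * 𝟙 (isGoodDiag L X σ))

module RowSwitching {n : ℕ} (L : Fin n → Fin n → Bool) (X Y : Subset n)
                    (|X|≡|Y| : count (lookup X) ≡ count (lookup Y)) (i : Fin n) (Xi : lookup X i ≡ true) where

  open Pairs X Y

  good : Map n → Bool
  good = isGoodDiag L X

  k k′ m₁ : ℕ
  k  = count (λ y → lookup Y y ∧ L i y)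
  k′ = count (λ y → lookup Y y ∧ not (L i y))
  m₁ = count (λ x → lookup X x ∧ not (i == x))

  small large : Map n → ℕ
  small σ = 𝟙 (not (L i (lookup σ i)))
  large σ = 𝟙 (L i (lookup σ i))

  ∑pairs-at-i : (F : Fin n → Fin n → ℕ) → ∑pairs (λ x₁ x₂ → 𝟙 (i == x₁) * F x₁ x₂) ≡ ∑[ x₂ < n ] elsewhere i x₂ * F i x₂
  ∑pairs-at-i F = begin
    ∑[ x₁ < n ] (∑[ x₂ < n ] distinct x₁ x₂ * (𝟙 (i == x₁) * F x₁ x₂))
      ≡⟨ ∑-cong (allFin n) (λ x₁ → trans (∑-cong (allFin n) (λ x₂ → x*[y*z]≡y*[x*z] (distinct x₁ x₂) (𝟙 (i == x₁)) (F x₁ x₂)))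
                                          (∑-*ˡ (allFin n) (𝟙 (i == x₁)) (λ x₂ → distinct x₁ x₂ * F x₁ x₂))) ⟩
    ∑[ x₁ < n ] 𝟙 (i == x₁) * (∑[ x₂ < n ] distinct x₁ x₂ * F x₁ x₂)
      ≡⟨ ∑-δ n i (λ x₁ → ∑[ x₂ < n ] distinct x₁ x₂ * F x₁ x₂) ⟩
    ∑[ x₂ < n ] distinct i x₂ * F i x₂
      ≡⟨ ∑-cong (allFin n) (λ x₂ → cong (λ b → 𝟙 (b ∧ lookup X x₂ ∧ not (i == x₂)) * F i x₂) Xi) ⟩
    ∑[ x₂ < n ] elsewhere i x₂ * F i x₂
      ∎
    where open ≡-Reasoning

  count-elsewhere : ∀ {σ} → IsBijection X Y σ → (Q : Fin n → Bool) → Q (lookup σ i) ≡ false →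
    ∑[ x < n ] elsewhere i x * 𝟙 (Q (lookup σ x)) ≡ count (λ y → lookup Y y ∧ Q y)
  count-elsewhere {σ} bij Q Qσi≡false = begin
    ∑[ x < n ] elsewhere i x * 𝟙 (Q (lookup σ x))
      ≡⟨ cong₂ (λ b c → 𝟙 (b ∧ c) + (∑[ x < n ] elsewhere i x * 𝟙 (Q (lookup σ x)))) Xi Qσi≡false ⟨
    𝟙 (lookup X i ∧ Q (lookup σ i)) + (∑[ x < n ] elsewhere i x * 𝟙 (Q (lookup σ x)))
      ≡⟨ count-split-at i (Q ∘ lookup σ) ⟨
    count (λ x → lookup X x ∧ Q (lookup σ x))
      ≡⟨ count-∘-bijection bij |X|≡|Y| Q ⟩
    count (λ y → lookup Y y ∧ Q y)
      ∎
    where open ≡-Reasoning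

  k+k′≡m : k + k′ ≡ count (lookup X)
  k+k′≡m = trans (count-∧-not (lookup Y) (L i)) (sym |X|≡|Y|)

  m≡1+m₁ : count (lookup X) ≡ suc m₁
  m≡1+m₁ = count-remove (lookup X) i Xi

  to-large : Map n → Fin n → Fin n → ℕ
  to-large σ x₁ x₂ = 𝟙 (i == x₁) * (𝟙 (not (L x₁ (lookup σ x₁))) * 𝟙 (L x₁ (lookup σ x₂)))

  ∑pairs-to-large : ∀ σ → IsBijection X Y σ → ∑pairs (to-large σ) ≡ small σ * k
  ∑pairs-to-large σ bij = begin
    ∑pairs (to-large σ)
      ≡⟨ ∑pairs-at-i (λ x₁ x₂ → 𝟙 (not (L x₁ (lookup σ x₁))) * 𝟙 (L x₁ (lookup σ x₂))) ⟩
    ∑[ x < n ] elsewhere i x * (small σ * 𝟙 (L i (lookup σ x)))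
      ≡⟨ ∑-cong (allFin n) (λ x → x*[y*z]≡y*[x*z] (elsewhere i x) (small σ) (𝟙 (L i (lookup σ x)))) ⟩
    ∑[ x < n ] small σ * (elsewhere i x * 𝟙 (L i (lookup σ x)))
      ≡⟨ ∑-*ˡ (allFin n) (small σ) (λ x → elsewhere i x * 𝟙 (L i (lookup σ x))) ⟩
    small σ * (∑[ x < n ] elsewhere i x * 𝟙 (L i (lookup σ x)))
      ≡⟨ 𝟙-*-cong (not (L i (lookup σ i))) (count-elsewhere bij (L i) ∘ not-true⇒false) ⟩
    small σ * k
      ∎
    where open ≡-Reasoning

  ∑pairs-to-large-swapped : ∀ σ → IsBijection X Y σ → ∑pairs (λ x₁ x₂ → to-large (swap σ x₁ x₂) x₁ x₂) ≡ large σ * k′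
  ∑pairs-to-large-swapped σ bij = begin
    ∑pairs (λ x₁ x₂ → to-large (swap σ x₁ x₂) x₁ x₂)
      ≡⟨ ∑pairs-at-i (λ x₁ x₂ → 𝟙 (not (L x₁ (lookup (swap σ x₁ x₂) x₁))) * 𝟙 (L x₁ (lookup (swap σ x₁ x₂) x₂))) ⟩
    ∑[ x < n ] elsewhere i x * (𝟙 (not (L i (lookup (swap σ i x) i))) * 𝟙 (L i (lookup (swap σ i x) x)))
      ≡⟨ ∑-cong (allFin n) (λ x → cong₂ (λ u v → elsewhere i x * (𝟙 (not (L i u)) * 𝟙 (L i v))) (lookup-swap-ˡ σ i x) (lookup-swap-ʳ σ i x)) ⟩
    ∑[ x < n ] elsewhere i x * (𝟙 (not (L i (lookup σ x))) * large σ)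
      ≡⟨ ∑-cong (allFin n) (λ x → trans (cong (elsewhere i x *_) (*-comm _ (large σ))) (x*[y*z]≡y*[x*z] (elsewhere i x) (large σ) _)) ⟩
    ∑[ x < n ] large σ * (elsewhere i x * 𝟙 (not (L i (lookup σ x))))
      ≡⟨ ∑-*ˡ (allFin n) (large σ) (λ x → elsewhere i x * 𝟙 (not (L i (lookup σ x)))) ⟩
    large σ * (∑[ x < n ] elsewhere i x * 𝟙 (not (L i (lookup σ x))))
      ≡⟨ 𝟙-*-cong (L i (lookup σ i)) (count-elsewhere bij (not ∘ L i) ∘ cong not) ⟩
    large σ * k′
      ∎
    where open ≡-Reasoning

  balanced : ∑ (bijections X Y) (λ σ → small σ * k) ≡ ∑ (bijections X Y) (λ σ → large σ * k′)
  balanced = begin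
    ∑ (bijections X Y) (λ σ → small σ * k)                     ≡⟨ ∑-cong-All (All-IsBijection X Y) ∑pairs-to-large ⟨
    ∑switches to-large                                               ≡⟨ ∑switches-swap to-large ⟨
    ∑switches (λ σ x₁ x₂ → to-large (swap σ x₁ x₂) x₁ x₂)            ≡⟨ ∑-cong-All (All-IsBijection X Y) ∑pairs-to-large-swapped ⟩
    ∑ (bijections X Y) (λ σ → large σ * k′)                    ∎
    where open ≡-Reasoning

  good-to-large : Map n → Fin n → Fin n → ℕ
  good-to-large σ x₁ x₂ = 𝟙 (i == x₁) * (𝟙 (not (L x₁ (lookup σ x₁)) ∧ good σ) * 𝟙 (L x₁ (lookup σ x₂) ∧ not (L x₂ (lookup σ x₂))))

  small-good : Map n → ℕ
  small-good σ = 𝟙 (not (L i (lookup σ i)) ∧ good σ)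

  switching-σ : ∀ σ → IsBijection X Y σ → small-good σ * k ≤ ∑pairs (good-to-large σ) + small-good σ
  switching-σ σ bij = begin
    small-good σ * k                        ≤⟨ 𝟙-*-≤ (not (L i (lookup σ i)) ∧ good σ) k≤S+1 ⟩
    small-good σ * (S + 1)                  ≡⟨ *-distribˡ-+ (small-good σ) S 1 ⟩
    small-good σ * S + small-good σ * 1     ≡⟨ cong₂ _+_ (sym ∑pairs-good-to-large) (*-identityʳ (small-good σ)) ⟩
    ∑pairs (good-to-large σ) + small-good σ            ∎
    where
    open ≤-Reasoning
    s : Fin n → Fin n
    s = lookup σ

    S : ℕ
    S = ∑[ x < n ] elsewhere i x * 𝟙 (L i (s x) ∧ not (L x (s x)))

    ∑pairs-good-to-large : ∑pairs (good-to-large σ) ≡ small-good σ * S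
    ∑pairs-good-to-large = trans (∑pairs-at-i (λ x₁ x₂ → 𝟙 (not (L x₁ (s x₁)) ∧ good σ) * 𝟙 (L x₁ (s x₂) ∧ not (L x₂ (s x₂)))))
      (trans (∑-cong (allFin n) (λ x → x*[y*z]≡y*[x*z] (elsewhere i x) (small-good σ) _)) (∑-*ˡ (allFin n) (small-good σ) _))

    k≤S+1 : not (L i (s i)) ∧ good σ ≡ true → k ≤ S + 1
    k≤S+1 small∧good = begin
      k                                         ≡⟨ count-elsewhere bij (L i) small-at-i ⟨
      ∑[ x < n ] elsewhere i x * 𝟙 (L i (s x))    ≤⟨ ∑-elsewhere-≤-good L σ (L i ∘ s) Xi small-at-i (proj₂ (∧-true⁻ small∧good)) ⟩
      S + 1                                     ∎
      where
      small-at-i : L i (s i) ≡ false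
      small-at-i = not-true⇒false (proj₁ (∧-true⁻ small∧good))

  switching-σ-swapped : ∀ σ → ∑pairs (λ x₁ x₂ → good-to-large (swap σ x₁ x₂) x₁ x₂) ≤ 𝟙 (L i (lookup σ i) ∧ not (good σ)) * m₁
  switching-σ-swapped σ = begin
    ∑pairs (λ x₁ x₂ → good-to-large (swap σ x₁ x₂) x₁ x₂)
      ≡⟨ ∑pairs-at-i (λ x₁ x₂ → 𝟙 (not (L x₁ (lookup (swap σ x₁ x₂) x₁)) ∧ good (swap σ x₁ x₂))
                             * 𝟙 (L x₁ (lookup (swap σ x₁ x₂) x₂) ∧ not (L x₂ (lookup (swap σ x₁ x₂) x₂)))) ⟩
    ∑[ x < n ] elsewhere i x * (𝟙 (not (L i (lookup (swap σ i x) i)) ∧ good (swap σ i x))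
                           * 𝟙 (L i (lookup (swap σ i x) x) ∧ not (L x (lookup (swap σ i x) x))))
      ≡⟨ ∑-cong (allFin n) (λ x → cong₂ (λ u v → elsewhere i x * (𝟙 (not (L i u) ∧ good (swap σ i x)) * 𝟙 (L i v ∧ not (L x v))))
                                         (lookup-swap-ˡ σ i x) (lookup-swap-ʳ σ i x)) ⟩
    ∑[ x < n ] elsewhere i x * (𝟙 (not (L i (s x)) ∧ good (swap σ i x)) * 𝟙 (L i (s i) ∧ not (L x (s i))))
      ≤⟨ ∑-mono (allFin n) bad-before ⟩
    ∑[ x < n ] elsewhere i x * 𝟙 (L i (s i) ∧ not (good σ))
      ≡⟨ ∑-*ʳ (allFin n) (𝟙 (L i (s i) ∧ not (good σ))) (elsewhere i) ⟩
    m₁ * 𝟙 (L i (s i) ∧ not (good σ))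
      ≡⟨ *-comm m₁ _ ⟩
    𝟙 (L i (s i) ∧ not (good σ)) * m₁
      ∎
    where
    open ≤-Reasoning
    s : Fin n → Fin n
    s = lookup σ

    bad-before : ∀ x → elsewhere i x * (𝟙 (not (L i (s x)) ∧ good (swap σ i x)) * 𝟙 (L i (s i) ∧ not (L x (s i))))
                     ≤ elsewhere i x * 𝟙 (L i (s i) ∧ not (good σ))
    bad-before x = elsewhere-*-≤ i x (λ Xx i≢x →
      ≤-trans (≤-reflexive (sym (𝟙-∧ (not (L i (s x)) ∧ good (swap σ i x)) _))) (𝟙-mono (implication Xx i≢x)))
      where
      implication : lookup X x ≡ true → i ≢ x →
                    ((not (L i (s x)) ∧ good (swap σ i x)) ∧ (L i (s i) ∧ not (L x (s i)))) ≡ true →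
                    (L i (s i) ∧ not (good σ)) ≡ true
      implication Xx i≢x switched with ∧-true⁻ switched
      ... | new , old with ∧-true⁻ new | ∧-true⁻ old
      ...   | new₁-small , good′ | old-large , new₂-small =
        cong₂ _∧_ old-large (cong not (swap-good⇒bad L X σ Xi Xx i≢x old-large
                                         (not-true⇒false new₁-small) (not-true⇒false new₂-small) good′))

  switching : ∑ (bijections X Y) (λ σ → (small σ * 𝟙 (good σ)) * k)
            ≤ ∑ (bijections X Y) (λ σ → (large σ * 𝟙 (not (good σ))) * m₁)
              + ∑ (bijections X Y) (λ σ → small σ * 𝟙 (good σ))
  switching = begin
    ∑ V (λ σ → (small σ * 𝟙 (good σ)) * k)
      ≡⟨ ∑-cong V (λ σ → cong (_* k) (sym (𝟙-∧ (not (L i (lookup σ i))) (good σ)))) ⟩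
    ∑ V (λ σ → small-good σ * k)
      ≤⟨ ∑-mono-All (All-IsBijection X Y) switching-σ ⟩
    ∑ V (λ σ → ∑pairs (good-to-large σ) + small-good σ)
      ≡⟨ ∑-+ V (λ σ → ∑pairs (good-to-large σ)) small-good ⟩
    ∑switches good-to-large + ∑ V small-good
      ≡⟨ cong (_+ ∑ V small-good) (∑switches-swap good-to-large) ⟨
    ∑switches (λ σ x₁ x₂ → good-to-large (swap σ x₁ x₂) x₁ x₂) + ∑ V small-good
      ≤⟨ +-monoˡ-≤ _ (∑-mono V switching-σ-swapped) ⟩
    ∑ V (λ σ → 𝟙 (L i (lookup σ i) ∧ not (good σ)) * m₁) + ∑ V small-good
      ≡⟨ cong₂ _+_ (∑-cong V (λ σ → cong (_* m₁) (𝟙-∧ (L i (lookup σ i)) _))) (∑-cong V (λ σ → 𝟙-∧ (not (L i (lookup σ i))) (good σ))) ⟩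
    ∑ V (λ σ → (large σ * 𝟙 (not (good σ))) * m₁) + ∑ V (λ σ → small σ * 𝟙 (good σ))
      ∎
    where
    open ≤-Reasoning
    V : List (Map n)
    V = bijections X Y

  counts : SwitchingCounts L X Y k
  counts = record
    { k′ = k′ ; m₁ = m₁ ; small = small ; large = large
    ; small+large≡1 = λ σ _ → trans (+-comm (small σ) (large σ)) (𝟙-+-𝟙-not (L i (lookup σ i)))
    ; k+k′≡|X| = trans k+k′≡m (sym (countFin≡count (lookup X))) ; |X|≡1+m₁ = trans (countFin≡count (lookup X)) m≡1+m₁
    ; balanced = balanced ; switching = switching }

module ColumnSwitching {n : ℕ} (L : Fin n → Fin n → Bool) (X Y : Subset n)
                       (|X|≡|Y| : count (lookup X) ≡ count (lookup Y)) (j : Fin n) (Yj : lookup Y j ≡ true) where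

  open Pairs X Y

  good : Map n → Bool
  good = isGoodDiag L X

  k k′ m₁ : ℕ
  k  = count (λ x → lookup X x ∧ L x j)
  k′ = count (λ x → lookup X x ∧ not (L x j))
  m₁ = count (λ y → lookup Y y ∧ not (j == y))

  small large : Map n → ℕ
  small σ = count (λ x → lookup X x ∧ (lookup σ x == j) ∧ not (L x j))
  large σ = count (λ x → lookup X x ∧ (lookup σ x == j) ∧ L x j)

  m≡1+m₁ : count (lookup X) ≡ suc m₁
  m≡1+m₁ = trans |X|≡|Y| (count-remove (lookup Y) j Yj)

  small+large≡1 : ∀ σ → IsBijection X Y σ → small σ + large σ ≡ 1
  small+large≡1 σ bij = begin
    small σ + large σ
      ≡⟨ ∑-+ (allFin n) (λ x → 𝟙 (lookup X x ∧ (lookup σ x == j) ∧ not (L x j))) (λ x → 𝟙 (lookup X x ∧ (lookup σ x == j) ∧ L x j)) ⟨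
    ∑[ x < n ] (𝟙 (lookup X x ∧ (lookup σ x == j) ∧ not (L x j)) + 𝟙 (lookup X x ∧ (lookup σ x == j) ∧ L x j))
      ≡⟨ ∑-cong (allFin n) (λ x → split (lookup X x) (lookup σ x == j) (L x j)) ⟩
    count (λ x → lookup X x ∧ (lookup σ x == j))
      ≡⟨ count-∘-bijection bij |X|≡|Y| (_== j) ⟩
    count (λ y → lookup Y y ∧ (y == j))
      ≡⟨ ∑-cong (allFin n) (λ y → trans (cong (λ b → 𝟙 (lookup Y y ∧ b)) (==-sym y j)) (trans (𝟙-∧ (lookup Y y) _) (*-comm (𝟙 (lookup Y y)) _))) ⟩
    ∑[ y < n ] 𝟙 (j == y) * 𝟙 (lookup Y y)
      ≡⟨ ∑-δ n j (𝟙 ∘ lookup Y) ⟩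
    𝟙 (lookup Y j)
      ≡⟨ cong 𝟙 Yj ⟩
    1 ∎
    where
    open ≡-Reasoning
    split : ∀ a b l → 𝟙 (a ∧ b ∧ not l) + 𝟙 (a ∧ b ∧ l) ≡ 𝟙 (a ∧ b)
    split true  true  true  = refl
    split true  true  false = refl
    split true  false l     = refl
    split false b     l     = refl

  to-large : Map n → Fin n → Fin n → ℕ
  to-large σ x₁ x₂ = 𝟙 ((lookup σ x₁ == j) ∧ not (L x₁ j)) * 𝟙 (L x₂ j)

  ∑pairs-to-large : ∀ σ → ∑pairs (to-large σ) ≡ small σ * k
  ∑pairs-to-large σ = begin
    ∑pairs (to-large σ)
      ≡⟨ ∑pairs-factor (λ x → (lookup σ x == j) ∧ not (L x j)) (λ _ x₂ → 𝟙 (L x₂ j)) ⟩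
    ∑[ x < n ] 𝟙 (lookup X x ∧ (lookup σ x == j) ∧ not (L x j)) * (∑[ x₂ < n ] elsewhere x x₂ * 𝟙 (L x₂ j))
      ≡⟨ ∑-cong (allFin n) (λ x → 𝟙-*-cong (lookup X x ∧ (lookup σ x == j) ∧ not (L x j)) (λ meets →
           count-elsewhere-≡ x (λ x₂ → L x₂ j) (not-true⇒false (proj₂ (∧-true⁻ {lookup σ x == j} (proj₂ (∧-true⁻ {lookup X x} meets))))))) ⟩
    ∑[ x < n ] 𝟙 (lookup X x ∧ (lookup σ x == j) ∧ not (L x j)) * k
      ≡⟨ ∑-*ʳ (allFin n) k (λ x → 𝟙 (lookup X x ∧ (lookup σ x == j) ∧ not (L x j))) ⟩
    small σ * k
      ∎
    where open ≡-Reasoning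

  ∑pairs-to-large-swapped : ∀ σ → ∑pairs (λ x₁ x₂ → to-large (swap σ x₁ x₂) x₂ x₁) ≡ large σ * k′
  ∑pairs-to-large-swapped σ = begin
    ∑pairs (λ x₁ x₂ → to-large (swap σ x₁ x₂) x₂ x₁)
      ≡⟨ ∑pairs-cong (λ x₁ x₂ → trans (cong (λ y → 𝟙 ((y == j) ∧ not (L x₂ j)) * 𝟙 (L x₁ j)) (lookup-swap-ʳ σ x₁ x₂))
                                      (trade (lookup σ x₁ == j) (not (L x₂ j)) (L x₁ j))) ⟩
    ∑pairs (λ x₁ x₂ → 𝟙 ((lookup σ x₁ == j) ∧ L x₁ j) * 𝟙 (not (L x₂ j)))
      ≡⟨ ∑pairs-factor (λ x → (lookup σ x == j) ∧ L x j) (λ _ x₂ → 𝟙 (not (L x₂ j))) ⟩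
    ∑[ x < n ] 𝟙 (lookup X x ∧ (lookup σ x == j) ∧ L x j) * (∑[ x₂ < n ] elsewhere x x₂ * 𝟙 (not (L x₂ j)))
      ≡⟨ ∑-cong (allFin n) (λ x → 𝟙-*-cong (lookup X x ∧ (lookup σ x == j) ∧ L x j) (λ meets →
           count-elsewhere-≡ x (λ x₂ → not (L x₂ j)) (cong not (proj₂ (∧-true⁻ {lookup σ x == j} (proj₂ (∧-true⁻ {lookup X x} meets))))))) ⟩
    ∑[ x < n ] 𝟙 (lookup X x ∧ (lookup σ x == j) ∧ L x j) * k′
      ≡⟨ ∑-*ʳ (allFin n) k′ (λ x → 𝟙 (lookup X x ∧ (lookup σ x == j) ∧ L x j)) ⟩
    large σ * k′
      ∎
    where
    open ≡-Reasoning
    trade : ∀ c a b → 𝟙 (c ∧ a) * 𝟙 b ≡ 𝟙 (c ∧ b) * 𝟙 a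
    trade true  a b = *-comm (𝟙 a) (𝟙 b)
    trade false a b = refl

  balanced : ∑ (bijections X Y) (λ σ → small σ * k) ≡ ∑ (bijections X Y) (λ σ → large σ * k′)
  balanced = begin
    ∑ (bijections X Y) (λ σ → small σ * k)             ≡⟨ ∑-cong (bijections X Y) ∑pairs-to-large ⟨
    ∑switches to-large                                       ≡⟨ ∑switches-swap-flip to-large ⟨
    ∑switches (λ σ x₁ x₂ → to-large (swap σ x₁ x₂) x₂ x₁)    ≡⟨ ∑-cong (bijections X Y) ∑pairs-to-large-swapped ⟩
    ∑ (bijections X Y) (λ σ → large σ * k′)            ∎
    where open ≡-Reasoning

  good-to-large : Map n → Fin n → Fin n → ℕ
  good-to-large σ x₁ x₂ = 𝟙 ((lookup σ x₁ == j) ∧ not (L x₁ j) ∧ good σ) * 𝟙 (L x₂ j ∧ not (L x₂ (lookup σ x₂)))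

  small-good large-bad : Map n → ℕ
  small-good σ = count (λ x → lookup X x ∧ (lookup σ x == j) ∧ not (L x j) ∧ good σ)
  large-bad  σ = count (λ x → lookup X x ∧ (lookup σ x == j) ∧ L x j ∧ not (good σ))

  switching-σ : ∀ σ → small-good σ * k ≤ ∑pairs (good-to-large σ) + small-good σ
  switching-σ σ = begin
    small-good σ * k
      ≡⟨ ∑-*ʳ (allFin n) k (λ x → 𝟙 (meets-small-good x)) ⟨
    ∑[ x < n ] 𝟙 (meets-small-good x) * k
      ≤⟨ ∑-mono (allFin n) (λ x → 𝟙-*-≤ (meets-small-good x) (k≤S+1 x)) ⟩
    ∑[ x < n ] 𝟙 (meets-small-good x) * (S x + 1)
      ≡⟨ ∑-cong (allFin n) (λ x → trans (*-distribˡ-+ (𝟙 (meets-small-good x)) (S x) 1) (cong (𝟙 (meets-small-good x) * S x +_) (*-identityʳ _))) ⟩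
    ∑[ x < n ] (𝟙 (meets-small-good x) * S x + 𝟙 (meets-small-good x))
      ≡⟨ ∑-+ (allFin n) (λ x → 𝟙 (meets-small-good x) * S x) (λ x → 𝟙 (meets-small-good x)) ⟩
    (∑[ x < n ] 𝟙 (meets-small-good x) * S x) + small-good σ
      ≡⟨ cong (_+ small-good σ) (∑pairs-factor (λ x → (lookup σ x == j) ∧ not (L x j) ∧ good σ)
                                              (λ _ x₂ → 𝟙 (L x₂ j ∧ not (L x₂ (lookup σ x₂))))) ⟨
    ∑pairs (good-to-large σ) + small-good σ
      ∎
    where
    open ≤-Reasoning
    meets-small-good : Fin n → Bool
    meets-small-good x = lookup X x ∧ (lookup σ x == j) ∧ not (L x j) ∧ good σ

    S : Fin n → ℕ
    S x = ∑[ x₂ < n ] elsewhere x x₂ * 𝟙 (L x₂ j ∧ not (L x₂ (lookup σ x₂)))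

    k≤S+1 : ∀ x → meets-small-good x ≡ true → k ≤ S x + 1
    k≤S+1 x hit with ∧-true⁻ {lookup X x} hit
    ... | Xx , rest with ∧-true⁻ {lookup σ x == j} rest
    ...   | σx=j , rest′ with ∧-true⁻ {not (L x j)} rest′
    ...     | small , good-σ = begin
      k                                         ≡⟨ count-elsewhere-≡ x (λ x₂ → L x₂ j) (not-true⇒false small) ⟨
      ∑[ x₂ < n ] elsewhere x x₂ * 𝟙 (L x₂ j)     ≤⟨ ∑-elsewhere-≤-good L σ (λ x₂ → L x₂ j) Xx
                                                       (trans (cong (L x) (==⇒≡ σx=j)) (not-true⇒false small)) good-σ ⟩
      S x + 1                                   ∎

  switching-σ-swapped : ∀ σ → ∑pairs (λ x₁ x₂ → good-to-large (swap σ x₁ x₂) x₂ x₁) ≤ large-bad σ * m₁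
  switching-σ-swapped σ = begin
    ∑pairs (λ x₁ x₂ → good-to-large (swap σ x₁ x₂) x₂ x₁)
      ≤⟨ ∑pairs-mono bad-before ⟩
    ∑pairs (λ x₁ x₂ → 𝟙 (meets-large-bad x₁) * 1)
      ≡⟨ ∑pairs-factor meets-large-bad (λ _ _ → 1) ⟩
    ∑[ x < n ] 𝟙 (lookup X x ∧ meets-large-bad x) * (∑[ x₂ < n ] elsewhere x x₂ * 1)
      ≡⟨ ∑-cong (allFin n) (λ x → 𝟙-*-cong (lookup X x ∧ meets-large-bad x)
           (λ hit → ∑-elsewhere m₁ (proj₁ (∧-true⁻ {lookup X x} hit)) m≡1+m₁)) ⟩
    ∑[ x < n ] 𝟙 (lookup X x ∧ meets-large-bad x) * m₁
      ≡⟨ ∑-*ʳ (allFin n) m₁ (λ x → 𝟙 (lookup X x ∧ meets-large-bad x)) ⟩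
    large-bad σ * m₁
      ∎
    where
    open ≤-Reasoning
    meets-large-bad : Fin n → Bool
    meets-large-bad x = (lookup σ x == j) ∧ L x j ∧ not (good σ)

    bad-before : ∀ x₁ x₂ → lookup X x₁ ≡ true → lookup X x₂ ≡ true → x₁ ≢ x₂ →
                 good-to-large (swap σ x₁ x₂) x₂ x₁ ≤ 𝟙 (meets-large-bad x₁) * 1
    bad-before x₁ x₂ Xx₁ Xx₂ x₁≢x₂ = begin
      good-to-large (swap σ x₁ x₂) x₂ x₁
        ≡⟨ cong₂ (λ u v → 𝟙 ((u == j) ∧ not (L x₂ j) ∧ good σ′) * 𝟙 (L x₁ j ∧ not (L x₁ v)))
                 (lookup-swap-ʳ σ x₁ x₂) (lookup-swap-ˡ σ x₁ x₂) ⟩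
      𝟙 ((lookup σ x₁ == j) ∧ not (L x₂ j) ∧ good σ′) * 𝟙 (L x₁ j ∧ not (L x₁ (lookup σ x₂)))
        ≡⟨ 𝟙-∧ ((lookup σ x₁ == j) ∧ not (L x₂ j) ∧ good σ′) _ ⟨
      𝟙 (((lookup σ x₁ == j) ∧ not (L x₂ j) ∧ good σ′) ∧ (L x₁ j ∧ not (L x₁ (lookup σ x₂))))
        ≤⟨ 𝟙-mono implication ⟩
      𝟙 (meets-large-bad x₁)
        ≡⟨ *-identityʳ _ ⟨
      𝟙 (meets-large-bad x₁) * 1
        ∎
      where
      σ′ : Map n
      σ′ = swap σ x₁ x₂
      implication : (((lookup σ x₁ == j) ∧ not (L x₂ j) ∧ good σ′) ∧ (L x₁ j ∧ not (L x₁ (lookup σ x₂)))) ≡ true →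
                    meets-large-bad x₁ ≡ true
      implication switched with ∧-true⁻ {(lookup σ x₁ == j) ∧ not (L x₂ j) ∧ good σ′} switched
      ... | new , old with ∧-true⁻ {lookup σ x₁ == j} new | ∧-true⁻ {L x₁ j} old
      ...   | σx₁=j , new′ | old-large , new₁-small with ∧-true⁻ {not (L x₂ j)} new′
      ...     | new₂-small , good′ =
        cong₂ _∧_ σx₁=j (cong₂ _∧_ old-large (cong not (swap-good⇒bad L X σ Xx₁ Xx₂ x₁≢x₂
          (trans (cong (L x₁) σx₁≡j) old-large) (not-true⇒false new₁-small)
          (trans (cong (L x₂) σx₁≡j) (not-true⇒false new₂-small)) good′)))
        where
        σx₁≡j : lookup σ x₁ ≡ j
        σx₁≡j = ==⇒≡ σx₁=j

  switching : ∑ (bijections X Y) (λ σ → (small σ * 𝟙 (good σ)) * k)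
            ≤ ∑ (bijections X Y) (λ σ → (large σ * 𝟙 (not (good σ))) * m₁)
              + ∑ (bijections X Y) (λ σ → small σ * 𝟙 (good σ))
  switching = begin
    ∑ V (λ σ → (small σ * 𝟙 (good σ)) * k)
      ≡⟨ ∑-cong V (λ σ → cong (_* k) (small-good≡ σ)) ⟨
    ∑ V (λ σ → small-good σ * k)
      ≤⟨ ∑-mono V switching-σ ⟩
    ∑ V (λ σ → ∑pairs (good-to-large σ) + small-good σ)
      ≡⟨ ∑-+ V (λ σ → ∑pairs (good-to-large σ)) small-good ⟩
    ∑switches good-to-large + ∑ V small-good
      ≡⟨ cong (_+ ∑ V small-good) (∑switches-swap-flip good-to-large) ⟨
    ∑switches (λ σ x₁ x₂ → good-to-large (swap σ x₁ x₂) x₂ x₁) + ∑ V small-good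
      ≤⟨ +-monoˡ-≤ _ (∑-mono V switching-σ-swapped) ⟩
    ∑ V (λ σ → large-bad σ * m₁) + ∑ V small-good
      ≡⟨ cong₂ _+_ (∑-cong V (λ σ → cong (_* m₁) (large-bad≡ σ))) (∑-cong V small-good≡) ⟩
    ∑ V (λ σ → (large σ * 𝟙 (not (good σ))) * m₁) + ∑ V (λ σ → small σ * 𝟙 (good σ))
      ∎
    where
    open ≤-Reasoning
    V : List (Map n)
    V = bijections X Y

    small-good≡ : ∀ σ → small-good σ ≡ small σ * 𝟙 (good σ)
    small-good≡ σ = trans (∑-cong (allFin n) (λ x → 𝟙-∧-last (lookup X x) (lookup σ x == j) (not (L x j)) (good σ)))
                          (∑-*ʳ (allFin n) (𝟙 (good σ)) (λ x → 𝟙 (lookup X x ∧ (lookup σ x == j) ∧ not (L x j))))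

    large-bad≡ : ∀ σ → large-bad σ ≡ large σ * 𝟙 (not (good σ))
    large-bad≡ σ = trans (∑-cong (allFin n) (λ x → 𝟙-∧-last (lookup X x) (lookup σ x == j) (L x j) (not (good σ))))
                         (∑-*ʳ (allFin n) (𝟙 (not (good σ))) (λ x → 𝟙 (lookup X x ∧ (lookup σ x == j) ∧ L x j)))

  counts : SwitchingCounts L X Y k
  counts = record
    { k′ = k′ ; m₁ = m₁ ; small = small ; large = large ; small+large≡1 = small+large≡1
    ; k+k′≡|X| = trans (count-∧-not (lookup X) (λ x → L x j)) (sym (countFin≡count (lookup X)))
    ; |X|≡1+m₁ = trans (countFin≡count (lookup X)) m≡1+m₁ ; balanced = balanced ; switching = switching }

module _ {n : ℕ} {L : Fin n → Fin n → Bool} {X Y : Subset n} {k : ℕ} (counts : SwitchingCounts L X Y k) where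

  open SwitchingCounts counts

  private
    V : List (Map n)
    V = bijections X Y

    good : Map n → Bool
    good = isGoodDiag L X

  -- Balancing turns k₁ k′ |V| into k₁ m ∑ small; splitting ∑ small into its good and bad parts,
  -- the switching inequality bounds k₁ times the good part by m₁ times the bad diagonals.
  switching-bound : ∀ k₁ → k ≡ suc k₁ →
    k₁ * k′ * length V ≤ sizeOf X * (m₁ + k₁) * ∑ V (λ σ → 𝟙 (not (good σ)))
  switching-bound k₁ k≡1+k₁ = begin
    k₁ * k′ * length V                       ≡⟨ cong (k₁ * k′ *_) (trans (sym (∑-const1 V)) |V|≡) ⟩
    k₁ * k′ * (SM + LA)                      ≡⟨ solve-∀-balance k₁ k′ SM LA ⟩
    k₁ * (k′ * LA + k′ * SM)                 ≡⟨ cong (λ z → k₁ * (z + k′ * SM)) (sym k·SM≡k′·LA) ⟩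
    k₁ * (k * SM + k′ * SM)                  ≡⟨ cong (k₁ *_) (sym (*-distribʳ-+ SM k k′)) ⟩
    k₁ * ((k + k′) * SM)                     ≡⟨ cong (λ z → k₁ * (z * SM)) k+k′≡|X| ⟩
    k₁ * (m * SM)                            ≡⟨ cong (λ z → k₁ * (m * z)) SM≡ ⟩
    k₁ * (m * (SG + SB))                     ≡⟨ solve-∀-distribute k₁ m SG SB ⟩
    m * (k₁ * SG + k₁ * SB)                  ≤⟨ *-monoʳ-≤ m (+-monoˡ-≤ (k₁ * SB) k₁·SG≤m₁·LB) ⟩
    m * (m₁ * LB + k₁ * SB)                  ≤⟨ *-monoʳ-≤ m (+-mono-≤ (*-monoˡ-≤ LB (m≤m+n m₁ k₁)) (*-monoˡ-≤ SB (m≤n+m k₁ m₁))) ⟩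
    m * ((m₁ + k₁) * LB + (m₁ + k₁) * SB)    ≡⟨ solve-∀-collect m (m₁ + k₁) LB SB ⟩
    m * (m₁ + k₁) * (LB + SB)                ≡⟨ cong (m * (m₁ + k₁) *_) (sym bad≡) ⟩
    m * (m₁ + k₁) * ∑ V (λ σ → 𝟙 (not (good σ)))  ∎
    where
    open ≤-Reasoning
    m = sizeOf X
    SM = ∑ V small
    LA = ∑ V large
    SG = ∑ V (λ σ → small σ * 𝟙 (good σ))
    SB = ∑ V (λ σ → small σ * 𝟙 (not (good σ)))
    LB = ∑ V (λ σ → large σ * 𝟙 (not (good σ)))

    |V|≡ : ∑ V (λ _ → 1) ≡ SM + LA
    |V|≡ = trans (sym (∑-cong-All (All-IsBijection X Y) small+large≡1)) (∑-+ V small large)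

    SM≡ : SM ≡ SG + SB
    SM≡ = trans (∑-cong V (λ σ → trans (sym (*-identityʳ (small σ)))
                   (trans (cong (small σ *_) (sym (𝟙-+-𝟙-not (good σ)))) (*-distribˡ-+ (small σ) _ _))))
                (∑-+ V _ _)

    bad≡ : ∑ V (λ σ → 𝟙 (not (good σ))) ≡ LB + SB
    bad≡ = trans (∑-cong-All (All-IsBijection X Y) (λ σ bij → trans (sym (*-identityˡ (𝟙 (not (good σ)))))
                   (trans (cong (_* 𝟙 (not (good σ))) (trans (sym (small+large≡1 σ bij)) (+-comm (small σ) (large σ))))
                          (*-distribʳ-+ (𝟙 (not (good σ))) (large σ) (small σ)))))
                 (∑-+ V _ _)

    k·SM≡k′·LA : k * SM ≡ k′ * LA
    k·SM≡k′·LA = trans (*-comm k SM) (trans (sym (∑-*ʳ V k small)) (trans balanced (trans (∑-*ʳ V k′ large) (*-comm LA k′))))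

    k₁·SG≤m₁·LB : k₁ * SG ≤ m₁ * LB
    k₁·SG≤m₁·LB = +-cancelʳ-≤ SG (k₁ * SG) (m₁ * LB) (begin
      k₁ * SG + SG     ≡⟨ +-comm (k₁ * SG) SG ⟩
      suc k₁ * SG      ≡⟨ cong (_* SG) k≡1+k₁ ⟨
      k * SG           ≡⟨ trans (*-comm k SG) (sym (∑-*ʳ V k (λ σ → small σ * 𝟙 (good σ)))) ⟩
      ∑ V (λ σ → (small σ * 𝟙 (good σ)) * k)
                       ≤⟨ switching ⟩
      LB′ + SG         ≡⟨ cong (_+ SG) (trans (∑-*ʳ V m₁ (λ σ → large σ * 𝟙 (not (good σ)))) (*-comm LB m₁)) ⟩
      m₁ * LB + SG     ∎)
      where
      LB′ = ∑ V (λ σ → (large σ * 𝟙 (not (good σ))) * m₁)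

    solve-∀-balance : ∀ k₁ k′ a b → k₁ * k′ * (a + b) ≡ k₁ * (k′ * b + k′ * a)
    solve-∀-balance = solve-∀
    solve-∀-distribute : ∀ k₁ m g b → k₁ * (m * (g + b)) ≡ m * (k₁ * g + k₁ * b)
    solve-∀-distribute = solve-∀
    solve-∀-collect : ∀ m c a b → m * (c * a + c * b) ≡ m * c * (a + b)
    solve-∀-collect = solve-∀

-- Rational arithmetic

open +-*-Solver using (solve; _:+_; _:-_; _:*_; _:=_; con)

private
  ℕ→ℚ-mkℚ : ∀ a → ℕ→ℚ a ≡ mkℚ (+ℤ a) 0 (λ (_ , d∣1) → ∣1⇒≡1 d∣1)
  ℕ→ℚ-mkℚ a = ℚ.normalize-coprime {a} {0} (λ (_ , d∣1) → ∣1⇒≡1 d∣1)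

ℕ→ℚ-+ : ∀ a b → ℕ→ℚ (a + b) ≡ ℕ→ℚ a +ℚ ℕ→ℚ b
ℕ→ℚ-+ a b rewrite ℕ→ℚ-mkℚ a | ℕ→ℚ-mkℚ b = sym (cong₂ (λ u v → (u +ℤ v) / 1) (ℤ.*-identityʳ (+ℤ a)) (ℤ.*-identityʳ (+ℤ b)))

ℕ→ℚ-* : ∀ a b → ℕ→ℚ (a * b) ≡ ℕ→ℚ a *ℚ ℕ→ℚ b
ℕ→ℚ-* a b = sym (trans (cong₂ _*ℚ_ (ℕ→ℚ-mkℚ a) (ℕ→ℚ-mkℚ b)) (cong (_/ 1) (sym (ℤ.pos-* a b))))

ℕ→ℚ-mono-≤ : ∀ {a b} → a ≤ b → ℕ→ℚ a ≤ℚ ℕ→ℚ b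
ℕ→ℚ-mono-≤ {a} {b} a≤b rewrite ℕ→ℚ-mkℚ a | ℕ→ℚ-mkℚ b =
  *≤* (subst₂ _≤ℤ_ (sym (ℤ.*-identityʳ (+ℤ a))) (sym (ℤ.*-identityʳ (+ℤ b))) (+≤+ a≤b))

ℕ→ℚ-nonNeg : ∀ a → 0ℚ ≤ℚ ℕ→ℚ a
ℕ→ℚ-nonNeg a = ℕ→ℚ-mono-≤ {0} {a} z≤n

ℕ→ℚ-pos : ∀ {a} → 1 ≤ a → 0ℚ <ℚ ℕ→ℚ a
ℕ→ℚ-pos 1≤a = ℚ.<-≤-trans (*<* (+<+ (s≤s z≤n))) (ℕ→ℚ-mono-≤ 1≤a)

ℕ→ℚ>1⇒≥2 : ∀ {k} → 1ℚ <ℚ ℕ→ℚ k → ∃ λ k₁ → k ≡ suc k₁ × 1 ≤ k₁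
ℕ→ℚ>1⇒≥2 {zero}        1<0 = ⊥-elim (ℚ.<-irrefl refl (ℚ.<-≤-trans 1<0 (ℕ→ℚ-nonNeg 1)))
ℕ→ℚ>1⇒≥2 {suc zero}    1<1 = ⊥-elim (ℚ.<-irrefl refl 1<1)
ℕ→ℚ>1⇒≥2 {suc (suc k)} _   = suc k , refl , s≤s z≤n

≤-translate : ∀ {a b} c {l r} → a +ℚ c ≡ l → b +ℚ c ≡ r → a ≤ℚ b → l ≤ℚ r
≤-translate c refl refl a≤b = ℚ.+-monoˡ-≤ c a≤b

complement-⇒ : ∀ s x y → (1ℚ -ℚ s) *ℚ (x +ℚ y) ≤ℚ x → y ≤ℚ s *ℚ (x +ℚ y)
complement-⇒ s x y = ≤-translate (y -ℚ (1ℚ -ℚ s) *ℚ (x +ℚ y))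
  (solve 3 (λ s x y → ((con 1ℚ :- s) :* (x :+ y)) :+ (y :- (con 1ℚ :- s) :* (x :+ y)) := y) refl s x y)
  (solve 3 (λ s x y → x :+ (y :- (con 1ℚ :- s) :* (x :+ y)) := s :* (x :+ y)) refl s x y)

complement-⇐ : ∀ s x y → y ≤ℚ s *ℚ (x +ℚ y) → (1ℚ -ℚ s) *ℚ (x +ℚ y) ≤ℚ x
complement-⇐ s x y = ≤-translate (x -ℚ s *ℚ (x +ℚ y))
  (solve 3 (λ s x y → y :+ (x :- s :* (x :+ y)) := (con 1ℚ :- s) :* (x :+ y)) refl s x y)
  (solve 3 (λ s x y → s :* (x :+ y) :+ (x :- s :* (x :+ y)) := x) refl s x y)

0≤p*q : ∀ {p q} → 0ℚ ≤ℚ p → 0ℚ ≤ℚ q → 0ℚ ≤ℚ p *ℚ q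
0≤p*q {p} {q} 0≤p 0≤q = subst (_≤ℚ p *ℚ q) (ℚ.*-zeroʳ p) (ℚ.*-monoˡ-≤-nonNeg p {{nonNegative 0≤p}} 0≤q)

0≤-of-≤-*pos : ∀ {b q M} → 0ℚ ≤ℚ b → b ≤ℚ q *ℚ M → 0ℚ <ℚ M → 0ℚ ≤ℚ q
0≤-of-≤-*pos {b} {q} {M} 0≤b b≤qM 0<M =
  ℚ.*-cancelʳ-≤-pos M {{positive 0<M}} (subst (_≤ℚ q *ℚ M) (sym (ℚ.*-zeroˡ M)) (ℚ.≤-trans 0≤b b≤qM))

0≤-of-1<*pos : ∀ {r m} → 0ℚ ≤ℚ m → 1ℚ <ℚ r *ℚ m → 0ℚ ≤ℚ r
0≤-of-1<*pos {r} {m} 0≤m 1<rm with ℚ.≤-total 0ℚ r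
... | inj₁ 0≤r = 0≤r
... | inj₂ r≤0 = ⊥-elim (ℚ.<-irrefl refl (ℚ.<-trans (*<* (+<+ (s≤s z≤n)))
      (ℚ.<-≤-trans 1<rm (subst (r *ℚ m ≤ℚ_) (ℚ.*-zeroˡ m) (ℚ.*-monoʳ-≤-nonNeg m {{nonNegative 0≤m}} r≤0)))))

line-bound : ∀ {m m₁ k₁ k′ q ϱ} → 0ℚ ≤ℚ m → m₁ ≤ℚ m → 0ℚ <ℚ k₁ → 0ℚ ≤ℚ q →
  k₁ *ℚ k′ ≤ℚ m *ℚ (m₁ +ℚ k₁) *ℚ q → q *ℚ m ≤ℚ ϱ *ℚ k₁ → k′ ≤ℚ (q +ℚ ϱ) *ℚ m
line-bound {m} {m₁} {k₁} {k′} {q} {ϱ} 0≤m m₁≤m 0<k₁ 0≤q k₁k′≤ qm≤ϱk₁ = ℚ.*-cancelˡ-≤-pos k₁ {{positive 0<k₁}} (begin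
  k₁ *ℚ k′                              ≤⟨ k₁k′≤ ⟩
  m *ℚ (m₁ +ℚ k₁) *ℚ q                   ≡⟨ solve 4 (λ m m₁ k₁ q → m :* (m₁ :+ k₁) :* q := m :* (m₁ :* q) :+ m :* k₁ :* q) refl m m₁ k₁ q ⟩
  m *ℚ (m₁ *ℚ q) +ℚ m *ℚ k₁ *ℚ q          ≤⟨ ℚ.+-monoˡ-≤ (m *ℚ k₁ *ℚ q) (ℚ.*-monoˡ-≤-nonNeg m {{nonNegative 0≤m}} m₁q≤ϱk₁) ⟩
  m *ℚ (ϱ *ℚ k₁) +ℚ m *ℚ k₁ *ℚ q          ≡⟨ solve 4 (λ m k₁ q ϱ → m :* (ϱ :* k₁) :+ m :* k₁ :* q := k₁ :* ((q :+ ϱ) :* m)) refl m k₁ q ϱ ⟩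
  k₁ *ℚ ((q +ℚ ϱ) *ℚ m)                  ∎)
  where
  open ℚ.≤-Reasoning
  m₁q≤ϱk₁ : m₁ *ℚ q ≤ℚ ϱ *ℚ k₁
  m₁q≤ϱk₁ = ℚ.≤-trans (ℚ.*-monoʳ-≤-nonNeg q {{nonNegative 0≤q}} m₁≤m) (subst (_≤ℚ ϱ *ℚ k₁) (ℚ.*-comm q m) qm≤ϱk₁)

strong-line : ∀ (m k₁ k′ m₁ M G B : ℕ) (p q ϱ : ℚ) →
  1 ≤ k₁ → suc k₁ + k′ ≡ m → m ≡ suc m₁ → G + B ≡ M → 1 ≤ M →
  k₁ * k′ * M ≤ m * (m₁ + k₁) * B →
  (1ℚ -ℚ q) *ℚ ℕ→ℚ M ≤ℚ ℕ→ℚ G →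
  (1ℚ -ℚ p) *ℚ ℕ→ℚ m ≤ℚ ℕ→ℚ (suc k₁) →
  ϱ *ℚ (1ℚ -ℚ p) ≡ ℕ→ℚ 2 *ℚ q →
  1ℚ <ℚ (ℕ→ℚ 2 *ℚ ϱ) *ℚ ℕ→ℚ m →
  (1ℚ -ℚ (q +ℚ ℕ→ℚ 3 *ℚ ϱ)) *ℚ ℕ→ℚ m ≤ℚ ℕ→ℚ (suc k₁)
strong-line m k₁ k′ m₁ M G B p q ϱ 1≤k₁ k+k′≡m m≡1+m₁ G+B≡M 1≤M counting good-share strong ϱ-def 1<2ϱm =
  subst (λ z → (1ℚ -ℚ s) *ℚ z ≤ℚ k) k+k′≡mℚ (complement-⇐ s k k′ℚ (subst (λ z → k′ℚ ≤ℚ s *ℚ z) (sym k+k′≡mℚ) k′≤sm))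
  where
  open ℚ.≤-Reasoning
  s k mℚ Mℚ k₁ℚ k′ℚ c : ℚ
  s = q +ℚ ℕ→ℚ 3 *ℚ ϱ
  k = ℕ→ℚ (suc k₁)
  mℚ = ℕ→ℚ m
  Mℚ = ℕ→ℚ M
  k₁ℚ = ℕ→ℚ k₁
  k′ℚ = ℕ→ℚ k′
  c = mℚ *ℚ (ℕ→ℚ m₁ +ℚ k₁ℚ)

  k+k′≡mℚ : k +ℚ k′ℚ ≡ mℚ
  k+k′≡mℚ = trans (sym (ℕ→ℚ-+ (suc k₁) k′)) (cong ℕ→ℚ k+k′≡m)

  B≤qM : ℕ→ℚ B ≤ℚ q *ℚ Mℚ
  B≤qM = subst (λ z → ℕ→ℚ B ≤ℚ q *ℚ z) G+B≡Mℚ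
    (complement-⇒ q (ℕ→ℚ G) (ℕ→ℚ B) (subst (λ z → (1ℚ -ℚ q) *ℚ z ≤ℚ ℕ→ℚ G) (sym G+B≡Mℚ) good-share))
    where
    G+B≡Mℚ : ℕ→ℚ G +ℚ ℕ→ℚ B ≡ Mℚ
    G+B≡Mℚ = trans (sym (ℕ→ℚ-+ G B)) (cong ℕ→ℚ G+B≡M)

  0<M : 0ℚ <ℚ Mℚ
  0<M = ℕ→ℚ-pos 1≤M

  0≤q : 0ℚ ≤ℚ q
  0≤q = 0≤-of-≤-*pos (ℕ→ℚ-nonNeg B) B≤qM 0<M

  0≤c : 0ℚ ≤ℚ c
  0≤c = 0≤p*q (ℕ→ℚ-nonNeg m) (subst (0ℚ ≤ℚ_) (ℕ→ℚ-+ m₁ k₁) (ℕ→ℚ-nonNeg (m₁ + k₁)))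

  k₁k′≤cq : k₁ℚ *ℚ k′ℚ ≤ℚ c *ℚ q
  k₁k′≤cq = ℚ.*-cancelʳ-≤-pos Mℚ {{positive 0<M}} (begin
    k₁ℚ *ℚ k′ℚ *ℚ Mℚ    ≡⟨ trans (ℕ→ℚ-* (k₁ * k′) M) (cong (_*ℚ Mℚ) (ℕ→ℚ-* k₁ k′)) ⟨
    ℕ→ℚ (k₁ * k′ * M)   ≤⟨ ℕ→ℚ-mono-≤ counting ⟩
    ℕ→ℚ (m * (m₁ + k₁) * B)
                        ≡⟨ trans (ℕ→ℚ-* (m * (m₁ + k₁)) B) (cong (_*ℚ ℕ→ℚ B) (trans (ℕ→ℚ-* m (m₁ + k₁)) (cong (mℚ *ℚ_) (ℕ→ℚ-+ m₁ k₁)))) ⟩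
    c *ℚ ℕ→ℚ B          ≤⟨ ℚ.*-monoˡ-≤-nonNeg c {{nonNegative 0≤c}} B≤qM ⟩
    c *ℚ (q *ℚ Mℚ)      ≡⟨ ℚ.*-assoc c q Mℚ ⟨
    c *ℚ q *ℚ Mℚ        ∎)

  0≤ϱ : 0ℚ ≤ℚ ϱ
  0≤ϱ = ℚ.*-cancelˡ-≤-pos (ℕ→ℚ 2) (subst (_≤ℚ ℕ→ℚ 2 *ℚ ϱ) (sym (ℚ.*-zeroʳ (ℕ→ℚ 2))) (0≤-of-1<*pos (ℕ→ℚ-nonNeg m) 1<2ϱm))

  qm≤ϱk₁ : q *ℚ mℚ ≤ℚ ϱ *ℚ k₁ℚ
  qm≤ϱk₁ = ℚ.*-cancelˡ-≤-pos (ℕ→ℚ 2) (begin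
    ℕ→ℚ 2 *ℚ (q *ℚ mℚ)       ≡⟨ ℚ.*-assoc (ℕ→ℚ 2) q mℚ ⟨
    ℕ→ℚ 2 *ℚ q *ℚ mℚ         ≡⟨ cong (_*ℚ mℚ) ϱ-def ⟨
    ϱ *ℚ (1ℚ -ℚ p) *ℚ mℚ     ≡⟨ ℚ.*-assoc ϱ (1ℚ -ℚ p) mℚ ⟩
    ϱ *ℚ ((1ℚ -ℚ p) *ℚ mℚ)   ≤⟨ ℚ.*-monoˡ-≤-nonNeg ϱ {{nonNegative 0≤ϱ}} strong ⟩
    ϱ *ℚ k                   ≤⟨ ℚ.*-monoˡ-≤-nonNeg ϱ {{nonNegative 0≤ϱ}} (subst (k ≤ℚ_) (ℕ→ℚ-+ k₁ k₁) (ℕ→ℚ-mono-≤ (+-monoˡ-≤ k₁ 1≤k₁))) ⟩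
    ϱ *ℚ (k₁ℚ +ℚ k₁ℚ)        ≡⟨ solve 2 (λ ϱ k₁ → ϱ :* (k₁ :+ k₁) := (con 1ℚ :+ con 1ℚ) :* (ϱ :* k₁)) refl ϱ k₁ℚ ⟩
    ℕ→ℚ 2 *ℚ (ϱ *ℚ k₁ℚ)      ∎)

  k′≤sm : k′ℚ ≤ℚ s *ℚ mℚ
  k′≤sm = begin
    k′ℚ                  ≤⟨ line-bound (ℕ→ℚ-nonNeg m) (ℕ→ℚ-mono-≤ m₁≤m) (ℕ→ℚ-pos 1≤k₁) 0≤q k₁k′≤cq qm≤ϱk₁ ⟩
    (q +ℚ ϱ) *ℚ mℚ       ≤⟨ ℚ.*-monoʳ-≤-nonNeg mℚ {{nonNegative (ℕ→ℚ-nonNeg m)}} (ℚ.+-monoʳ-≤ q ϱ≤3ϱ) ⟩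
    s *ℚ mℚ              ∎
    where
    m₁≤m : m₁ ≤ m
    m₁≤m = subst (m₁ ≤_) (sym m≡1+m₁) (n≤1+n m₁)
    ϱ≤3ϱ : ϱ ≤ℚ ℕ→ℚ 3 *ℚ ϱ
    ϱ≤3ϱ = subst₂ _≤ℚ_ (ℚ.*-identityˡ ϱ) refl (ℚ.*-monoʳ-≤-nonNeg ϱ {{nonNegative 0≤ϱ}} (ℕ→ℚ-mono-≤ {1} {3} (s≤s z≤n)))

module _ {n : ℕ} (L : Fin n → Fin n → Bool) (X Y : Subset n) (|X|≡|Y| : sizeOf X ≡ sizeOf Y) {p q ϱ : ℚ}
         (good-share : QGood L X Y q) (1<[1-p]m : 1ℚ <ℚ (1ℚ -ℚ p) *ℚ ℕ→ℚ (sizeOf X))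
         (ϱ-def : ϱ *ℚ (1ℚ -ℚ p) ≡ ℕ→ℚ 2 *ℚ q) (1<2ϱm : 1ℚ <ℚ (ℕ→ℚ 2 *ℚ ϱ) *ℚ ℕ→ℚ (sizeOf X)) where

  private
    s : ℚ
    s = q +ℚ ℕ→ℚ 3 *ℚ ϱ

    V : List (Map n)
    V = bijections X Y

    good : Map n → Bool
    good = isGoodDiag L X

    |X|≡|Y|′ : count (lookup X) ≡ count (lookup Y)
    |X|≡|Y|′ = trans (sym (countFin≡count (lookup X))) (trans |X|≡|Y| (countFin≡count (lookup Y)))

    good+bad≡all : length (filterᵇ good V) + ∑ V (λ σ → 𝟙 (not (good σ))) ≡ length V
    good+bad≡all = trans (cong (_+ ∑ V (λ σ → 𝟙 (not (good σ)))) (length-filterᵇ good V))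
      (trans (sym (∑-+ V (𝟙 ∘ good) (λ σ → 𝟙 (not (good σ))))) (trans (∑-cong V (𝟙-+-𝟙-not ∘ good)) (∑-const1 V)))

    strong-line-of : ∀ {k} → SwitchingCounts L X Y k →
      (1ℚ -ℚ p) *ℚ ℕ→ℚ (sizeOf X) ≤ℚ ℕ→ℚ k → (1ℚ -ℚ s) *ℚ ℕ→ℚ (sizeOf X) ≤ℚ ℕ→ℚ k
    strong-line-of {k} counts strong with ℕ→ℚ>1⇒≥2 {k} (ℚ.<-≤-trans 1<[1-p]m strong)
    ... | k₁ , refl , 1≤k₁ =
      strong-line (sizeOf X) k₁ k′ m₁ (length V) (length (filterᵇ good V)) (∑ V (λ σ → 𝟙 (not (good σ)))) p q ϱ
        1≤k₁ k+k′≡|X| |X|≡1+m₁ good+bad≡all (bijections-nonempty X Y |X|≡|Y|′) (switching-bound counts k₁ refl)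
        good-share strong ϱ-def 1<2ϱm
      where open SwitchingCounts counts

    strengthen-via : ∀ {a b k} → a ≡ sizeOf X → b ≡ k → SwitchingCounts L X Y k →
      (1ℚ -ℚ p) *ℚ ℕ→ℚ a ≤ℚ ℕ→ℚ b → (1ℚ -ℚ s) *ℚ ℕ→ℚ a ≤ℚ ℕ→ℚ b
    strengthen-via refl refl = strong-line-of

  strengthen : ∀ ℓ → LineOf X Y ℓ → Strong L X Y p ℓ → Strong L X Y s ℓ
  strengthen (row i) Xi =
    strengthen-via (sym |X|≡|Y|) (countFin≡count (λ j → lookup Y j ∧ L i j)) (RowSwitching.counts L X Y |X|≡|Y|′ i Xi)
  strengthen (col j) Yj =
    strengthen-via refl (countFin≡count (λ i → lookup X i ∧ L i j)) (ColumnSwitching.counts L X Y |X|≡|Y|′ j Yj)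

lemma14 : (n : ℕ) → 1 ≤ n →
    (F : Map n → Bool) → 2 * card F ≡ n ! →
    (c : Fin n → Fin n → ℚ) → IsProjU1 (fOf F) c →
    (X Y : Subset n) → sizeOf X ≡ sizeOf Y →
    (p q ϱ : ℚ) →
    QGood (λ i j → isLarge (epsOf (fOf F) (spanT c)) (aOf (fOf F) i j)) X Y q →
    (ℓ : Line n) → LineOf X Y ℓ →
    Strong (λ i j → isLarge (epsOf (fOf F) (spanT c)) (aOf (fOf F) i j)) X Y p ℓ →
    6 ≤ sizeOf X →
    1ℚ <ℚ (1ℚ -ℚ p) *ℚ ℕ→ℚ (sizeOf X) →
    ϱ *ℚ (1ℚ -ℚ p) ≡ ℕ→ℚ 2 *ℚ q →
    1ℚ <ℚ (ℕ→ℚ 2 *ℚ ϱ) *ℚ ℕ→ℚ (sizeOf X) →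
    ϱ ≤ℚ ½ →
    Strong (λ i j → isLarge (epsOf (fOf F) (spanT c)) (aOf (fOf F) i j)) X Y
      (q +ℚ ℕ→ℚ 3 *ℚ ϱ) ℓ
lemma14 n _ F _ c _ X Y |X|≡|Y| p q ϱ good-share ℓ ℓ∈ strong _ 1<[1-p]m ϱ-def 1<2ϱm _ =
  strengthen (λ i j → isLarge (epsOf (fOf F) (spanT c)) (aOf (fOf F) i j)) X Y |X|≡|Y| {p} {q} {ϱ}
    good-share 1<[1-p]m ϱ-def 1<2ϱm ℓ ℓ∈ strong
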